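{- Let $n\ge4$ be even and let $D$ be the matrix in the context. Then \[D^\dagger\mathbf{1}=\Big(\frac{ -3n+13}{n^2+3n-4},\ \frac{ -n+6}{n^2+3n-4}\mathbf{1}_{n-1}',\ \frac{1}{n+4}\mathbf{1}_{n-1}'\Big)'.\]
   Context: $\mathbf{1}_p$ all-ones vector in $\mathbb{R}^p$, $\mathbf{1}=\mathbf{1}_{2n-1}$, $J_p=\mathbf{1}_p\mathbf{1}_p'$, $I_p$ identity, $X'$ transpose, $X^\dagger$ Moore–Penrose inverse. $\mathrm{Circ}(a_1,\dots,a_p)$ is the circulant matrix with first row $(a_1,\dots,a_p)$, each subsequent row the previous one shifted cyclically one position to the right. $S=\mathrm{Circ}(1,3,\dots,3,1)$ (size $n-1$, $n-3$ threes), $T=\mathrm{Circ}(0,2,4,\dots,4,2)$ (size $n-1$, $n-4$ fours), and \[D=\begin{bmatrix}0&\mathbf{1}_{n-1}'&2\mathbf{1}_{n-1}'\\ \mathbf{1}_{n-1}&2(J_{n-1}-I_{n-1})&S\\ 2\mathbf{1}_{n-1}&S'&T\end{bmatrix}\] (the distance matrix of the gear graph on $2n-1$ vertices). -}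

module Defs where

open import Data.Nat as ℕ using (ℕ; zero; suc; _∸_; _≤ᵇ_; _≡ᵇ_; _<ᵇ_)
open import Data.Integer as ℤ using (ℤ; +_)
open import Data.Rational as ℚ using (ℚ; 0ℚ)
open import Data.Fin using (Fin; toℕ)
open import Data.Bool using (Bool; true; false; if_then_else_; _∨_)
open import Data.List using (List; foldr; map)
open import Data.Fin.Base using ()
open import Data.List using (allFin) public

Matrix : ℕ → ℕ → Set
Matrix m k = Fin m → Fin k → ℚ

Vector : ℕ → Set
Vector m = Fin m → ℚ

∑ : (m : ℕ) → (Fin m → ℚ) → ℚ
∑ m f = foldr ℚ._+_ 0ℚ (map f (allFin m))

_·_ : ∀ {a b c} → Matrix a b → Matrix b c → Matrix a c
_·_ {b = b} A B i j = ∑ b (λ l → ℚ._*_ (A i l) (B l j))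

_·ᵥ_ : ∀ {a b} → Matrix a b → Vector b → Vector a
_·ᵥ_ {b = b} A v i = ∑ b (λ l → ℚ._*_ (A i l) (v l))

transpose : ∀ {a b} → Matrix a b → Matrix b a
transpose A i j = A j i

_≈ₘ_ : ∀ {a b} → Matrix a b → Matrix a b → Set
A ≈ₘ B = ∀ i j → A i j ≡ B i j
  where open import Relation.Binary.PropositionalEquality using (_≡_)

record IsMoorePenrose {a b : ℕ} (A : Matrix a b) (X : Matrix b a) : Set where
  field
    p1 : ((A · X) · A) ≈ₘ A
    p2 : ((X · A) · X) ≈ₘ X
    p3 : transpose (A · X) ≈ₘ (A · X)
    p4 : transpose (X · A) ≈ₘ (X · A)

ones : (m : ℕ) → Vector m
ones m _ = ℚ.1ℚ

cycOff : ℕ → ℕ → ℕ → ℕ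
cycOff p j k = if j ≤ᵇ k then k ∸ j else (k ℕ.+ p) ∸ j

-- S = Circ(1,3,...,3,1) of size p: entry (j,k) = a_{((k-j) mod p)+1}
sEntry : ℕ → ℕ → ℕ → ℕ
sEntry p j k = let d = cycOff p j k in
  if (d ≡ᵇ 0) ∨ (d ≡ᵇ (p ∸ 1)) then 1 else 3

-- T = Circ(0,2,4,...,4,2) of size p
tEntry : ℕ → ℕ → ℕ → ℕ
tEntry p j k = let d = cycOff p j k in
  if d ≡ᵇ 0 then 0 else if (d ≡ᵇ 1) ∨ (d ≡ᵇ (p ∸ 1)) then 2 else 4

-- Block structure of indices 0 .. 2n-2 : index 0 is the first block (size 1),
-- indices 1 .. n-1 the second block, indices n .. 2n-2 the third block.
data Blk : Set where
  b0 b1 b2 : Blk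

blk : ℕ → ℕ → Blk
blk n zero = b0
blk n (suc i) = if i <ᵇ (n ∸ 1) then b1 else b2

pos : ℕ → ℕ → ℕ
pos n zero = 0
pos n (suc i) = if i <ᵇ (n ∸ 1) then i else i ∸ (n ∸ 1)

dEntryℕ : ℕ → ℕ → ℕ → ℕ
dEntryℕ n i k = go (blk n i) (blk n k) (pos n i) (pos n k)
  where
  p = n ∸ 1
  go : Blk → Blk → ℕ → ℕ → ℕ
  go b0 b0 _ _ = 0
  go b0 b1 _ _ = 1
  go b0 b2 _ _ = 2
  go b1 b0 _ _ = 1
  go b2 b0 _ _ = 2
  go b1 b1 j l = if j ≡ᵇ l then 0 else 2
  go b1 b2 j l = sEntry p j l
  go b2 b1 j l = sEntry p l j
  go b2 b2 j l = tEntry p j l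

-- the gear-graph distance matrix D of size 2n-1
gearD : (n : ℕ) → Matrix (2 ℕ.* n ∸ 1) (2 ℕ.* n ∸ 1)
gearD n i k = (+ dEntryℕ n (toℕ i) (toℕ k)) ℚ./ 1

-- a / d as a rational (d = 0 never occurs in the statement since n ≥ 4)
frac : ℤ → ℕ → ℚ
frac a zero = 0ℚ
frac a (suc d) = a ℚ./ suc d

targetVec : (n : ℕ) → Vector (2 ℕ.* n ∸ 1)
targetVec n i = go (blk n (toℕ i))
  where
  den = n ℕ.* n ℕ.+ 3 ℕ.* n ∸ 4
  go : Blk → ℚ
  go b0 = frac ((+ 13) ℤ.- (+ (3 ℕ.* n))) den
  go b1 = frac ((+ 6) ℤ.- (+ n)) den
  go b2 = frac (+ 1) (n ℕ.+ 4)

{-# OPTIONS --safe #-}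

-- Let p = n - 1. The column of D indexed by the degree-2 vertex between rim vertices l and l + 1
-- is minus the hub column plus the columns of those two rim vertices. Hence D = Fᵗ M F, where M
-- is the leading (1 + p) × (1 + p) block of D, an invertible matrix, and F = [I | K] with K
-- recording these column relations. F has full row rank: F Fᵗ = I + K Kᵗ is inverted by p
-- Sherman–Morrison updates, each legitimate because I + K Kᵗ is positive semidefinite. Then
-- X = Fᵗ G M⁻¹ G F with G = (F Fᵗ)⁻¹ satisfies the Penrose equations.
-- The value of D†1 needs no formula for D†: for symmetric D every Moore–Penrose inverse X has
-- X D D = D, so X 1 = w as soon as D w = 1 and w = D z. Both identities are checked on vectors
-- that are constant on the three blocks, through the factorization.
module Submission where

open import Data.Nat using (ℕ)

module BoolEquality where

  open import Data.Nat using (_≡ᵇ_; _≟_)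
  open import Data.Nat.Properties using (≡ᵇ⇒≡; ≡⇒≡ᵇ)
  open import Data.Bool using (true; false; T)
  open import Data.Bool.Properties using (T-≡)
  open import Function.Bundles using (Equivalence)
  open import Data.Unit using (tt)
  open import Data.Empty using (⊥-elim)
  open import Relation.Nullary using (¬_; yes; no)
  open import Relation.Binary.PropositionalEquality

  T⇒≡true : ∀ {b} → T b → b ≡ true
  T⇒≡true = Equivalence.to T-≡

  ¬T⇒≡false : ∀ {b} → ¬ T b → b ≡ false
  ¬T⇒≡false {true} ¬t = ⊥-elim (¬t tt)
  ¬T⇒≡false {false} _ = refl

  ≡⇒≡ᵇ-true : ∀ {a b} → a ≡ b → (a ≡ᵇ b) ≡ true
  ≡⇒≡ᵇ-true {a} {b} a≡b = T⇒≡true (≡⇒≡ᵇ a b a≡b)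

  ≢⇒≡ᵇ-false : ∀ {a b} → a ≢ b → (a ≡ᵇ b) ≡ false
  ≢⇒≡ᵇ-false {a} {b} a≢b = ¬T⇒≡false (λ t → a≢b (≡ᵇ⇒≡ a b t))

  ≡ᵇ-true⇒≡ : ∀ {a b} → (a ≡ᵇ b) ≡ true → a ≡ b
  ≡ᵇ-true⇒≡ {a} {b} e = ≡ᵇ⇒≡ a b (Equivalence.from T-≡ e)

  ≡ᵇ-cong-⇔ : ∀ {a b c d} → (a ≡ b → c ≡ d) → (c ≡ d → a ≡ b) → (a ≡ᵇ b) ≡ (c ≡ᵇ d)
  ≡ᵇ-cong-⇔ {a} {b} to from with a ≟ b
  ... | yes a≡b = trans (≡⇒≡ᵇ-true a≡b) (sym (≡⇒≡ᵇ-true (to a≡b)))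
  ... | no a≢b = trans (≢⇒≡ᵇ-false a≢b) (sym (≢⇒≡ᵇ-false (λ c≡d → a≢b (from c≡d))))

  ≡ᵇ-sym : ∀ a b → (a ≡ᵇ b) ≡ (b ≡ᵇ a)
  ≡ᵇ-sym a b = ≡ᵇ-cong-⇔ {a} {b} {b} {a} sym sym


module Matrices where

  open import Defs
  open import Data.Nat using (zero; suc; _≡ᵇ_)
  open import Data.Fin using (Fin; zero; suc; toℕ)
  open import Data.Rational using (ℚ; 0ℚ; 1ℚ; _+_; _*_)
  open import Data.Rational.Properties using (+-*-commutativeRing; *-comm; *-assoc; *-zeroʳ; *-identityʳ; +-identityʳ; +-identityˡ)
  open import Algebra.Bundles using (CommutativeRing)
  import Algebra.Properties.Semiring.Sum as SemiringSum
  open import Data.List using (foldr; map; tabulate)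
  open import Data.Bool using (Bool; true; false)
  open import Function using (_∘_)
  open import Relation.Binary.Bundles using (Setoid)
  import Relation.Binary.Reasoning.Setoid as SetoidReasoning
  open import Relation.Binary.PropositionalEquality
  open ≡-Reasoning
  open BoolEquality using (≡ᵇ-sym)

  private
    module Sum = SemiringSum (CommutativeRing.semiring +-*-commutativeRing)

    foldr-map-tabulate : ∀ {A : Set} m (f : A → ℚ) (g : Fin m → A) →
      foldr _+_ 0ℚ (map f (tabulate g)) ≡ Sum.sum (f ∘ g)
    foldr-map-tabulate zero f g = refl
    foldr-map-tabulate (suc m) f g = cong (f (g zero) +_) (foldr-map-tabulate m f (g ∘ suc))

  ∑≡sum : ∀ m (f : Fin m → ℚ) → ∑ m f ≡ Sum.sum f
  ∑≡sum m f = foldr-map-tabulate m f (λ i → i)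

  ∑-suc : ∀ m (f : Fin (suc m) → ℚ) → ∑ (suc m) f ≡ f zero + ∑ m (f ∘ suc)
  ∑-suc m f = trans (∑≡sum (suc m) f) (cong (f zero +_) (sym (∑≡sum m (f ∘ suc))))

  ∑-cong : ∀ m {f g : Fin m → ℚ} → (∀ i → f i ≡ g i) → ∑ m f ≡ ∑ m g
  ∑-cong m {f} {g} f≗g = begin
    ∑ m f        ≡⟨ ∑≡sum m f ⟩
    Sum.sum f    ≡⟨ Sum.sum-cong-≗ f≗g ⟩
    Sum.sum g    ≡⟨ ∑≡sum m g ⟨
    ∑ m g        ∎

  ∑-distrib-+ : ∀ m (f g : Fin m → ℚ) → ∑ m (λ i → f i + g i) ≡ ∑ m f + ∑ m g
  ∑-distrib-+ m f g = begin
    ∑ m (λ i → f i + g i)       ≡⟨ ∑≡sum m _ ⟩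
    Sum.sum (λ i → f i + g i)   ≡⟨ Sum.∑-distrib-+ f g ⟩
    Sum.sum f + Sum.sum g       ≡⟨ cong₂ _+_ (∑≡sum m f) (∑≡sum m g) ⟨
    ∑ m f + ∑ m g               ∎

  *-distribˡ-∑ : ∀ m c (f : Fin m → ℚ) → ∑ m (λ i → c * f i) ≡ c * ∑ m f
  *-distribˡ-∑ m c f = begin
    ∑ m (λ i → c * f i)       ≡⟨ ∑≡sum m _ ⟩
    Sum.sum (λ i → c * f i)   ≡⟨ Sum.*-distribˡ-sum c f ⟨
    c * Sum.sum f             ≡⟨ cong (c *_) (∑≡sum m f) ⟨
    c * ∑ m f                 ∎

  *-distribʳ-∑ : ∀ m c (f : Fin m → ℚ) → ∑ m (λ i → f i * c) ≡ ∑ m f * c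
  *-distribʳ-∑ m c f = begin
    ∑ m (λ i → f i * c)       ≡⟨ ∑≡sum m _ ⟩
    Sum.sum (λ i → f i * c)   ≡⟨ Sum.*-distribʳ-sum c f ⟨
    Sum.sum f * c             ≡⟨ cong (_* c) (∑≡sum m f) ⟨
    ∑ m f * c                 ∎

  ∑-comm : ∀ m k (f : Fin m → Fin k → ℚ) →
    ∑ m (λ i → ∑ k (f i)) ≡ ∑ k (λ j → ∑ m (λ i → f i j))
  ∑-comm m k f = begin
    ∑ m (λ i → ∑ k (f i))                   ≡⟨ ∑-cong m (λ i → ∑≡sum k (f i)) ⟩
    ∑ m (λ i → Sum.sum (f i))               ≡⟨ ∑≡sum m _ ⟩
    Sum.sum (λ i → Sum.sum (f i))           ≡⟨ Sum.∑-comm f ⟩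
    Sum.sum (λ j → Sum.sum (λ i → f i j))   ≡⟨ ∑≡sum k _ ⟨
    ∑ k (λ j → Sum.sum (λ i → f i j))       ≡⟨ ∑-cong k (λ j → ∑≡sum m (λ i → f i j)) ⟨
    ∑ k (λ j → ∑ m (λ i → f i j))           ∎

  ∑-zero : ∀ m → ∑ m (λ _ → 0ℚ) ≡ 0ℚ
  ∑-zero m = trans (∑≡sum m _) (Sum.sum-replicate-zero m)

  𝟙 : Bool → ℚ
  𝟙 true = 1ℚ
  𝟙 false = 0ℚ

  δ : ∀ {m} → Fin m → Fin m → ℚ
  δ i j = 𝟙 (toℕ i ≡ᵇ toℕ j)

  δ-sym : ∀ {m} (i j : Fin m) → δ i j ≡ δ j i
  δ-sym i j = cong 𝟙 (≡ᵇ-sym (toℕ i) (toℕ j))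

  ∑-δʳ : ∀ m (f : Fin m → ℚ) (a : Fin m) → ∑ m (λ j → f j * δ j a) ≡ f a
  ∑-δʳ (suc m) f zero = begin
    ∑ (suc m) (λ j → f j * δ j zero)          ≡⟨ ∑-suc m (λ j → f j * δ j zero) ⟩
    f zero * 1ℚ + ∑ m (λ j → f (suc j) * 0ℚ)  ≡⟨ cong₂ _+_ (*-identityʳ (f zero)) (trans (∑-cong m (λ j → *-zeroʳ (f (suc j)))) (∑-zero m)) ⟩
    f zero + 0ℚ                               ≡⟨ +-identityʳ (f zero) ⟩
    f zero                                    ∎
  ∑-δʳ (suc m) f (suc a) = begin
    ∑ (suc m) (λ j → f j * δ j (suc a))       ≡⟨ ∑-suc m (λ j → f j * δ j (suc a)) ⟩
    f zero * 0ℚ + ∑ m (λ j → f (suc j) * δ j a) ≡⟨ cong₂ _+_ (*-zeroʳ (f zero)) (∑-δʳ m (f ∘ suc) a) ⟩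
    0ℚ + f (suc a)                            ≡⟨ +-identityˡ (f (suc a)) ⟩
    f (suc a)                                 ∎

  ∑-δˡ : ∀ m (f : Fin m → ℚ) (a : Fin m) → ∑ m (λ j → δ a j * f j) ≡ f a
  ∑-δˡ m f a = trans (∑-cong m (λ j → trans (*-comm (δ a j) (f j)) (cong (f j *_) (δ-sym a j)))) (∑-δʳ m f a)

  ≈ₘ-setoid : ℕ → ℕ → Setoid _ _
  ≈ₘ-setoid a b = record
    { Carrier = Matrix a b
    ; _≈_ = _≈ₘ_
    ; isEquivalence = record
      { refl = λ i j → refl
      ; sym = λ e i j → sym (e i j)
      ; trans = λ e f i j → trans (e i j) (f i j) } }

  module ≈ₘ-Reasoning {a b : ℕ} = SetoidReasoning (≈ₘ-setoid a b)

  module _ {a b : ℕ} where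
    open Setoid (≈ₘ-setoid a b) public using () renaming (refl to ≈ₘ-refl; sym to ≈ₘ-sym; trans to ≈ₘ-trans)

  ·-cong : ∀ {a b c} {A A′ : Matrix a b} {B B′ : Matrix b c} → A ≈ₘ A′ → B ≈ₘ B′ → (A · B) ≈ₘ (A′ · B′)
  ·-cong {b = b} A≈ B≈ i j = ∑-cong b (λ l → cong₂ _*_ (A≈ i l) (B≈ l j))

  ·-congˡ : ∀ {a b c} (A : Matrix a b) {B B′ : Matrix b c} → B ≈ₘ B′ → (A · B) ≈ₘ (A · B′)
  ·-congˡ A = ·-cong (≈ₘ-refl {x = A})

  ·-congʳ : ∀ {a b c} {A A′ : Matrix a b} (B : Matrix b c) → A ≈ₘ A′ → (A · B) ≈ₘ (A′ · B)
  ·-congʳ B A≈ = ·-cong A≈ (≈ₘ-refl {x = B})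

  ·-assoc : ∀ {a b c d} (A : Matrix a b) (B : Matrix b c) (C : Matrix c d) → ((A · B) · C) ≈ₘ (A · (B · C))
  ·-assoc {b = b} {c = c} A B C i j = begin
    ∑ c (λ l → ∑ b (λ k → A i k * B k l) * C l j)   ≡⟨ ∑-cong c (λ l → *-distribʳ-∑ b (C l j) _) ⟨
    ∑ c (λ l → ∑ b (λ k → A i k * B k l * C l j))   ≡⟨ ∑-comm b c _ ⟨
    ∑ b (λ k → ∑ c (λ l → A i k * B k l * C l j))   ≡⟨ ∑-cong b (λ k → ∑-cong c (λ l → *-assoc (A i k) _ _)) ⟩
    ∑ b (λ k → ∑ c (λ l → A i k * (B k l * C l j))) ≡⟨ ∑-cong b (λ k → *-distribˡ-∑ c (A i k) _) ⟩
    ∑ b (λ k → A i k * ∑ c (λ l → B k l * C l j))   ∎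

  transpose-· : ∀ {a b c} (A : Matrix a b) (B : Matrix b c) → transpose (A · B) ≈ₘ (transpose B · transpose A)
  transpose-· {b = b} A B i j = ∑-cong b (λ l → *-comm (A j l) (B l i))

  transpose-cong : ∀ {a b} {A B : Matrix a b} → A ≈ₘ B → transpose A ≈ₘ transpose B
  transpose-cong A≈B i j = A≈B j i

  Symmetric : ∀ {r} → Matrix r r → Set
  Symmetric B = transpose B ≈ₘ B

  ·-identityˡ : ∀ {a b} (A : Matrix a b) → (δ · A) ≈ₘ A
  ·-identityˡ {a} A i j = ∑-δˡ a (λ l → A l j) i

  ·-identityʳ : ∀ {a b} (A : Matrix a b) → (A · δ) ≈ₘ A
  ·-identityʳ {b = b} A i j = ∑-δʳ b (A i) j

  asColumn : ∀ {a} → Vector a → Matrix a 1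
  asColumn v l _ = v l

  ·ᵥ-assoc : ∀ {a b c} (A : Matrix a b) (B : Matrix b c) (v : Vector c) → ∀ i → ((A · B) ·ᵥ v) i ≡ (A ·ᵥ (B ·ᵥ v)) i
  ·ᵥ-assoc A B v i = ·-assoc A B (asColumn v) i zero

  ·ᵥ-congˡ : ∀ {a b} {A A′ : Matrix a b} (v : Vector b) → A ≈ₘ A′ → ∀ i → (A ·ᵥ v) i ≡ (A′ ·ᵥ v) i
  ·ᵥ-congˡ v A≈ i = ·-congʳ (asColumn v) A≈ i zero

  ·ᵥ-congʳ : ∀ {a b} (A : Matrix a b) {v v′ : Vector b} → (∀ l → v l ≡ v′ l) → ∀ i → (A ·ᵥ v) i ≡ (A ·ᵥ v′) i
  ·ᵥ-congʳ A {v} {v′} v≗ i = ·-congˡ A {asColumn v} {asColumn v′} (λ l _ → v≗ l) i zero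


module MoorePenrose where

  open import Defs
  open Matrices
  open import Relation.Binary.PropositionalEquality using (_≡_; sym; module ≡-Reasoning)

  ·-cancelˡ : ∀ {a b c} (B : Matrix a b) (C : Matrix b a) (Y : Matrix a c) → (B · C) ≈ₘ δ → (B · (C · Y)) ≈ₘ Y
  ·-cancelˡ B C Y B·C≈I = ≈ₘ-trans (≈ₘ-sym (·-assoc B C Y)) (≈ₘ-trans (·-congʳ Y B·C≈I) (·-identityˡ Y))

  module FromFactorization {N r : ℕ} (A : Matrix N N) (F : Matrix r N) (M M⁻¹ G : Matrix r r)
    (A≈FᵗMF : A ≈ₘ (transpose F · (M · F)))
    (M·M⁻¹≈I : (M · M⁻¹) ≈ₘ δ) (M⁻¹·M≈I : (M⁻¹ · M) ≈ₘ δ)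
    (FFᵗ·G≈I : ((F · transpose F) · G) ≈ₘ δ) (G·FFᵗ≈I : (G · (F · transpose F)) ≈ₘ δ)
    (G-sym : Symmetric G) where

    private
      Fᵗ = transpose F

    X : Matrix N N
    X = Fᵗ · (G · (M⁻¹ · (G · F)))

    P : Matrix N N
    P = Fᵗ · (G · F)

    private
      F·Fᵗ·G-cancel : ∀ {c} (Y : Matrix r c) → (F · (Fᵗ · (G · Y))) ≈ₘ Y
      F·Fᵗ·G-cancel Y = ≈ₘ-trans (≈ₘ-sym (·-assoc F Fᵗ (G · Y))) (·-cancelˡ (F · Fᵗ) G Y FFᵗ·G≈I)

      G·F·Fᵗ-cancel : ∀ {c} (Y : Matrix r c) → (G · (F · (Fᵗ · Y))) ≈ₘ Y
      G·F·Fᵗ-cancel Y = ≈ₘ-trans (·-congˡ G (≈ₘ-sym (·-assoc F Fᵗ Y))) (·-cancelˡ G (F · Fᵗ) Y G·FFᵗ≈I)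

      open ≈ₘ-Reasoning

    A·X≈P : (A · X) ≈ₘ P
    A·X≈P = begin
      A · X                           ≈⟨ ·-congʳ X A≈FᵗMF ⟩
      (Fᵗ · (M · F)) · X              ≈⟨ ·-assoc Fᵗ (M · F) X ⟩
      Fᵗ · ((M · F) · X)              ≈⟨ ·-congˡ Fᵗ (·-assoc M F X) ⟩
      Fᵗ · (M · (F · X))              ≈⟨ ·-congˡ Fᵗ (·-congˡ M (F·Fᵗ·G-cancel (M⁻¹ · (G · F)))) ⟩
      Fᵗ · (M · (M⁻¹ · (G · F)))      ≈⟨ ·-congˡ Fᵗ (·-cancelˡ M M⁻¹ (G · F) M·M⁻¹≈I) ⟩
      P                               ∎

    X·A≈P : (X · A) ≈ₘ P
    X·A≈P = begin
      X · A                                         ≈⟨ ·-congˡ X A≈FᵗMF ⟩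
      X · (Fᵗ · (M · F))                            ≈⟨ ·-assoc Fᵗ (G · (M⁻¹ · (G · F))) (Fᵗ · (M · F)) ⟩
      Fᵗ · ((G · (M⁻¹ · (G · F))) · (Fᵗ · (M · F))) ≈⟨ ·-congˡ Fᵗ (·-assoc G (M⁻¹ · (G · F)) _) ⟩
      Fᵗ · (G · ((M⁻¹ · (G · F)) · (Fᵗ · (M · F)))) ≈⟨ ·-congˡ Fᵗ (·-congˡ G (·-assoc M⁻¹ (G · F) _)) ⟩
      Fᵗ · (G · (M⁻¹ · ((G · F) · (Fᵗ · (M · F))))) ≈⟨ ·-congˡ Fᵗ (·-congˡ G (·-congˡ M⁻¹ (·-assoc G F _))) ⟩
      Fᵗ · (G · (M⁻¹ · (G · (F · (Fᵗ · (M · F))))))  ≈⟨ ·-congˡ Fᵗ (·-congˡ G (·-congˡ M⁻¹ (G·F·Fᵗ-cancel (M · F)))) ⟩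
      Fᵗ · (G · (M⁻¹ · (M · F)))                    ≈⟨ ·-congˡ Fᵗ (·-congˡ G (·-cancelˡ M⁻¹ M F M⁻¹·M≈I)) ⟩
      P                                             ∎

    P-sym : Symmetric P
    P-sym = begin
      transpose P                 ≈⟨ transpose-· Fᵗ (G · F) ⟩
      transpose (G · F) · F       ≈⟨ ·-congʳ F (transpose-· G F) ⟩
      (Fᵗ · transpose G) · F      ≈⟨ ·-congʳ F (·-congˡ Fᵗ G-sym) ⟩
      (Fᵗ · G) · F                ≈⟨ ·-assoc Fᵗ G F ⟩
      P                           ∎

    P·A≈A : (P · A) ≈ₘ A
    P·A≈A = begin
      P · A                             ≈⟨ ·-congˡ P A≈FᵗMF ⟩
      P · (Fᵗ · (M · F))                ≈⟨ ·-assoc Fᵗ (G · F) (Fᵗ · (M · F)) ⟩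
      Fᵗ · ((G · F) · (Fᵗ · (M · F)))   ≈⟨ ·-congˡ Fᵗ (·-assoc G F (Fᵗ · (M · F))) ⟩
      Fᵗ · (G · (F · (Fᵗ · (M · F))))   ≈⟨ ·-congˡ Fᵗ (G·F·Fᵗ-cancel (M · F)) ⟩
      Fᵗ · (M · F)                      ≈⟨ A≈FᵗMF ⟨
      A                                 ∎

    P·X≈X : (P · X) ≈ₘ X
    P·X≈X = begin
      P · X                 ≈⟨ ·-assoc Fᵗ (G · F) X ⟩
      Fᵗ · ((G · F) · X)    ≈⟨ ·-congˡ Fᵗ (·-assoc G F X) ⟩
      Fᵗ · (G · (F · X))    ≈⟨ ·-congˡ Fᵗ (G·F·Fᵗ-cancel (G · (M⁻¹ · (G · F)))) ⟩
      X                     ∎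

    isMoorePenrose : IsMoorePenrose A X
    isMoorePenrose = record
      { p1 = ≈ₘ-trans (·-congʳ A A·X≈P) P·A≈A
      ; p2 = ≈ₘ-trans (·-congʳ X X·A≈P) P·X≈X
      ; p3 = ≈ₘ-trans (transpose-cong A·X≈P) (≈ₘ-trans P-sym (≈ₘ-sym A·X≈P))
      ; p4 = ≈ₘ-trans (transpose-cong X·A≈P) (≈ₘ-trans P-sym (≈ₘ-sym X·A≈P)) }

  module OfSymmetric {N : ℕ} {A X : Matrix N N} (A-sym : Symmetric A) (mp : IsMoorePenrose A X) where

    open IsMoorePenrose mp

    X·A·A≈A : ((X · A) · A) ≈ₘ A
    X·A·A≈A = begin
      (X · A) · A                                ≈⟨ ·-congʳ A (≈ₘ-sym p4) ⟩
      transpose (X · A) · A                      ≈⟨ ·-congʳ A (transpose-· X A) ⟩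
      (transpose A · transpose X) · A            ≈⟨ ·-congʳ A (·-congʳ (transpose X) A-sym) ⟩
      (A · transpose X) · A                      ≈⟨ ·-congˡ (A · transpose X) (≈ₘ-sym A-sym) ⟩
      (A · transpose X) · transpose A            ≈⟨ ·-assoc A (transpose X) (transpose A) ⟩
      A · (transpose X · transpose A)            ≈⟨ ·-congʳ (transpose X · transpose A) (≈ₘ-sym A-sym) ⟩
      transpose A · (transpose X · transpose A)  ≈⟨ ·-congˡ (transpose A) (transpose-· A X) ⟨
      transpose A · transpose (A · X)            ≈⟨ transpose-· (A · X) A ⟨
      transpose ((A · X) · A)                    ≈⟨ transpose-cong p1 ⟩
      transpose A                                ≈⟨ A-sym ⟩
      A                                          ∎
      where open ≈ₘ-Reasoning

    ·ᵥ-onImage : (v w z : Vector N) → (∀ i → (A ·ᵥ z) i ≡ w i) → (∀ i → (A ·ᵥ w) i ≡ v i) →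
      ∀ i → (X ·ᵥ v) i ≡ w i
    ·ᵥ-onImage v w z Az≡w Aw≡v i = begin
      (X ·ᵥ v) i              ≡⟨ ·ᵥ-congʳ X (λ l → sym (Aw≡v l)) i ⟩
      (X ·ᵥ (A ·ᵥ w)) i       ≡⟨ ·ᵥ-assoc X A w i ⟨
      ((X · A) ·ᵥ w) i        ≡⟨ ·ᵥ-congʳ (X · A) (λ l → sym (Az≡w l)) i ⟩
      ((X · A) ·ᵥ (A ·ᵥ z)) i ≡⟨ ·ᵥ-assoc (X · A) A z i ⟨
      (((X · A) · A) ·ᵥ z) i  ≡⟨ ·ᵥ-congˡ z X·A·A≈A i ⟩
      (A ·ᵥ z) i              ≡⟨ Az≡w i ⟩
      w i                     ∎
      where open ≡-Reasoning


module ShermanMorrison where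

  open import Defs
  open Matrices
  open import Data.Nat using (zero; suc)
  open import Data.Fin using (Fin; zero; suc)
  open import Data.Rational using (ℚ; 0ℚ; 1ℚ; _+_; _*_; -_; _-_; _≤_; 1/_; NonZero; nonNegative; nonPositive)
  open import Data.Rational.Properties
    using (*-comm; *-inverseˡ; +-identityʳ; ≤-total; ≤-refl; +-mono-≤; nonNegative⁻¹; nonNeg*nonNeg⇒nonNeg; nonPos*nonPos⇒nonPos; pos+nonNeg⇒pos; pos⇒nonZero)
  open import Data.Rational.Solver using (module +-*-Solver)
  open import Data.Sum using (inj₁; inj₂)
  open import Data.Product using (Σ; _×_; _,_; proj₁; proj₂)
  open import Function using (_∘_)
  open import Relation.Binary.PropositionalEquality
  open ≡-Reasoning
  open +-*-Solver

  SymmetricRightInverse : ∀ {r} → Matrix r r → Set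
  SymmetricRightInverse {r} B = Σ (Matrix r r) (λ G → ((B · G) ≈ₘ δ) × Symmetric G)

  rightInverse⇒leftInverse : ∀ {r} {B G : Matrix r r} → Symmetric B → Symmetric G → (B · G) ≈ₘ δ → (G · B) ≈ₘ δ
  rightInverse⇒leftInverse {r} {B} {G} B-sym G-sym B·G≈I i j = begin
    (G · B) i j                     ≡⟨ ∑-cong r (λ l → cong₂ _*_ (sym (G-sym i l)) (sym (B-sym l j))) ⟩
    (transpose G · transpose B) i j ≡⟨ transpose-· B G i j ⟨
    (B · G) j i                     ≡⟨ B·G≈I j i ⟩
    δ j i                           ≡⟨ δ-sym j i ⟩
    δ i j                           ∎

  quadForm : ∀ {r} → Matrix r r → Vector r → ℚ
  quadForm {r} B y = ∑ r (λ i → y i * (B ·ᵥ y) i)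

  addOuter : ∀ {r} → Matrix r r → Vector r → Matrix r r
  addOuter B v i j = B i j + v i * v j

  quadForm-addOuter : ∀ {r} (B : Matrix r r) (v y : Vector r) →
    quadForm (addOuter B v) y ≡ quadForm B y + ∑ r (λ j → v j * y j) * ∑ r (λ j → v j * y j)
  quadForm-addOuter {r} B v y = begin
    ∑ r (λ i → y i * ∑ r (λ j → (B i j + v i * v j) * y j))
      ≡⟨ ∑-cong r (λ i → cong (y i *_) (∑-cong r (λ j → solve 4 (λ b vi vj yj → (b :+ vi :* vj) :* yj := b :* yj :+ vi :* (vj :* yj)) refl (B i j) (v i) (v j) (y j)))) ⟩
    ∑ r (λ i → y i * ∑ r (λ j → B i j * y j + v i * (v j * y j)))
      ≡⟨ ∑-cong r (λ i → cong (y i *_) (trans (∑-distrib-+ r _ _) (cong ((B ·ᵥ y) i +_) (*-distribˡ-∑ r (v i) _)))) ⟩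
    ∑ r (λ i → y i * ((B ·ᵥ y) i + v i * t))
      ≡⟨ ∑-cong r (λ i → solve 4 (λ yi b vi t → yi :* (b :+ vi :* t) := yi :* b :+ (vi :* yi) :* t) refl (y i) ((B ·ᵥ y) i) (v i) t) ⟩
    ∑ r (λ i → y i * (B ·ᵥ y) i + (v i * y i) * t)
      ≡⟨ ∑-distrib-+ r _ _ ⟩
    quadForm B y + ∑ r (λ i → (v i * y i) * t)
      ≡⟨ cong (quadForm B y +_) (*-distribʳ-∑ r t _) ⟩
    quadForm B y + t * t ∎
    where t = ∑ r (λ j → v j * y j)

  ∑-*-expand : ∀ m (a b c d : Fin m → ℚ) x y →
    ∑ m (λ l → (a l + x * b l) * (c l - d l * y))
      ≡ ∑ m (λ l → a l * c l) - y * ∑ m (λ l → a l * d l) + x * ∑ m (λ l → b l * c l) - x * y * ∑ m (λ l → b l * d l)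
  ∑-*-expand m a b c d x y = begin
    ∑ m (λ l → (a l + x * b l) * (c l - d l * y))
      ≡⟨ ∑-cong m (λ l → solve 6 (λ a b c d x y → (a :+ x :* b) :* (c :- d :* y)
           := a :* c :+ (:- y) :* (a :* d) :+ x :* (b :* c) :+ (:- (x :* y)) :* (b :* d)) refl (a l) (b l) (c l) (d l) x y) ⟩
    ∑ m (λ l → a l * c l + (- y) * (a l * d l) + x * (b l * c l) + (- (x * y)) * (b l * d l))
      ≡⟨ trans (∑-distrib-+ m _ _) (cong₂ _+_ (trans (∑-distrib-+ m _ _) (cong₂ _+_ (∑-distrib-+ m _ _) refl)) refl) ⟩
    ∑ m (λ l → a l * c l) + ∑ m (λ l → (- y) * (a l * d l)) + ∑ m (λ l → x * (b l * c l)) + ∑ m (λ l → (- (x * y)) * (b l * d l))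
      ≡⟨ cong₂ _+_ (cong₂ _+_ (cong (∑ m (λ l → a l * c l) +_) (*-distribˡ-∑ m (- y) _)) (*-distribˡ-∑ m x _)) (*-distribˡ-∑ m (- (x * y)) _) ⟩
    ∑ m (λ l → a l * c l) + (- y) * ∑ m (λ l → a l * d l) + x * ∑ m (λ l → b l * c l) + (- (x * y)) * ∑ m (λ l → b l * d l)
      ≡⟨ solve 6 (λ p q r t x y → p :+ (:- y) :* q :+ x :* r :+ (:- (x :* y)) :* t := p :- y :* q :+ x :* r :- x :* y :* t) refl
           (∑ m (λ l → a l * c l)) (∑ m (λ l → a l * d l)) (∑ m (λ l → b l * c l)) (∑ m (λ l → b l * d l)) x y ⟩
    ∑ m (λ l → a l * c l) - y * ∑ m (λ l → a l * d l) + x * ∑ m (λ l → b l * c l) - x * y * ∑ m (λ l → b l * d l) ∎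

  module RankOneUpdate {r : ℕ} (B G : Matrix r r) (B·G≈I : (B · G) ≈ₘ δ) (G-sym : Symmetric G) (v : Vector r) where

    u : Vector r
    u = G ·ᵥ v

    s : ℚ
    s = ∑ r (λ l → v l * u l)

    B·u≡v : ∀ i → (B ·ᵥ u) i ≡ v i
    B·u≡v i = trans (sym (·ᵥ-assoc B G v i)) (trans (·ᵥ-congˡ v B·G≈I i) (∑-δˡ r v i))

    vᵗ·G≡u : ∀ j → ∑ r (λ l → v l * G l j) ≡ u j
    vᵗ·G≡u j = ∑-cong r (λ l → trans (*-comm (v l) (G l j)) (cong (_* v l) (G-sym j l)))

    s≡quadForm : s ≡ quadForm B u
    s≡quadForm = ∑-cong r (λ i → trans (*-comm (v i) (u i)) (cong (u i *_) (sym (B·u≡v i))))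

    module _ .{{_ : NonZero (1ℚ + s)}} where

      G′ : Matrix r r
      G′ i j = G i j - u i * (u j * 1/ (1ℚ + s))

      G′-sym : Symmetric G′
      G′-sym i j = cong₂ _-_ (G-sym i j) (solve 3 (λ a b c → a :* (b :* c) := b :* (a :* c)) refl (u j) (u i) (1/ (1ℚ + s)))

      addOuter·G′≈I : (addOuter B v · G′) ≈ₘ δ
      addOuter·G′≈I i j = begin
        ∑ r (λ l → (B i l + v i * v l) * (G l j - u l * (u j * c⁻¹)))
          ≡⟨ ∑-*-expand r (B i) v (λ l → G l j) u (v i) (u j * c⁻¹) ⟩
        (B · G) i j - u j * c⁻¹ * (B ·ᵥ u) i + v i * ∑ r (λ l → v l * G l j) - v i * (u j * c⁻¹) * s
          ≡⟨ cong₂ (λ e f → e - u j * c⁻¹ * f + v i * ∑ r (λ l → v l * G l j) - v i * (u j * c⁻¹) * s) (B·G≈I i j) (B·u≡v i) ⟩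
        δ i j - u j * c⁻¹ * v i + v i * ∑ r (λ l → v l * G l j) - v i * (u j * c⁻¹) * s
          ≡⟨ cong (λ e → δ i j - u j * c⁻¹ * v i + v i * e - v i * (u j * c⁻¹) * s) (vᵗ·G≡u j) ⟩
        δ i j - u j * c⁻¹ * v i + v i * u j - v i * (u j * c⁻¹) * s
          ≡⟨ solve 5 (λ d uj c vi s → d :- uj :* c :* vi :+ vi :* uj :- vi :* (uj :* c) :* s := d :+ vi :* uj :* (con 1ℚ :- c :* (con 1ℚ :+ s))) refl (δ i j) (u j) c⁻¹ (v i) s ⟩
        δ i j + v i * u j * (1ℚ - c⁻¹ * (1ℚ + s))
          ≡⟨ cong (λ e → δ i j + v i * u j * (1ℚ - e)) (*-inverseˡ (1ℚ + s)) ⟩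
        δ i j + v i * u j * (1ℚ - 1ℚ)
          ≡⟨ solve 3 (λ d a b → d :+ a :* b :* (con 1ℚ :- con 1ℚ) := d) refl (δ i j) (v i) (u j) ⟩
        δ i j ∎
        where c⁻¹ = 1/ (1ℚ + s)

  I+KKᵗ : ∀ {r k} → Matrix r k → Matrix r r
  I+KKᵗ {k = k} K i j = δ i j + ∑ k (λ l → K i l * K j l)

  module DropFirstColumn {r k : ℕ} (K : Matrix r (suc k)) where

    K₀ : Matrix r k
    K₀ i l = K i (suc l)

    v : Vector r
    v i = K i zero

    I+KKᵗ≈addOuter : I+KKᵗ K ≈ₘ addOuter (I+KKᵗ K₀) v
    I+KKᵗ≈addOuter i j = begin
      δ i j + ∑ (suc k) (λ l → K i l * K j l)          ≡⟨ cong (δ i j +_) (∑-suc k (λ l → K i l * K j l)) ⟩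
      δ i j + (v i * v j + ∑ k (λ l → K₀ i l * K₀ j l)) ≡⟨ solve 3 (λ a b c → a :+ (b :+ c) := (a :+ c) :+ b) refl (δ i j) (v i * v j) _ ⟩
      I+KKᵗ K₀ i j + v i * v j                         ∎

  0≤x*x : ∀ x → 0ℚ ≤ x * x
  0≤x*x x with ≤-total 0ℚ x
  ... | inj₁ 0≤x = nonNegative⁻¹ (x * x) {{nonNeg*nonNeg⇒nonNeg x {{nonNegative 0≤x}} x {{nonNegative 0≤x}}}}
  ... | inj₂ x≤0 = nonNegative⁻¹ (x * x) {{nonPos*nonPos⇒nonPos x {{nonPositive x≤0}} x {{nonPositive x≤0}}}}

  ∑-nonNeg : ∀ m (f : Fin m → ℚ) → (∀ i → 0ℚ ≤ f i) → 0ℚ ≤ ∑ m f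
  ∑-nonNeg zero f _ = ≤-refl
  ∑-nonNeg (suc m) f 0≤f = subst (0ℚ ≤_) (sym (∑-suc m f)) (+-mono-≤ (0≤f zero) (∑-nonNeg m (f ∘ suc) (0≤f ∘ suc)))

  quadForm-cong : ∀ {r} {B B′ : Matrix r r} → B ≈ₘ B′ → ∀ y → quadForm B y ≡ quadForm B′ y
  quadForm-cong {r} B≈B′ y = ∑-cong r (λ i → cong (y i *_) (·ᵥ-congˡ y B≈B′ i))

  quadForm-I+KKᵗ-nonNeg : ∀ {r} k (K : Matrix r k) (y : Vector r) → 0ℚ ≤ quadForm (I+KKᵗ K) y
  quadForm-I+KKᵗ-nonNeg {r} zero K y = subst (0ℚ ≤_) (sym quadForm≡∑y²) (∑-nonNeg r _ (λ i → 0≤x*x (y i)))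
    where
    quadForm≡∑y² : quadForm (I+KKᵗ K) y ≡ ∑ r (λ i → y i * y i)
    quadForm≡∑y² = ∑-cong r (λ i → cong (y i *_) (trans (∑-cong r (λ j → cong (_* y j) (+-identityʳ (δ i j)))) (∑-δˡ r y i)))
  quadForm-I+KKᵗ-nonNeg {r} (suc k) K y = subst (0ℚ ≤_) (sym quadForm≡)
    (+-mono-≤ (quadForm-I+KKᵗ-nonNeg k K₀ y) (0≤x*x (∑ r (λ j → v j * y j))))
    where
    open DropFirstColumn K
    quadForm≡ = trans (quadForm-cong I+KKᵗ≈addOuter y) (quadForm-addOuter (I+KKᵗ K₀) v y)

  I+KKᵗ-inverse : ∀ {r} k (K : Matrix r k) → SymmetricRightInverse (I+KKᵗ K)
  I+KKᵗ-inverse zero K = δ , (λ i j → trans (·-identityʳ (I+KKᵗ K) i j) (+-identityʳ (δ i j))) , (λ i j → δ-sym j i)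
  I+KKᵗ-inverse (suc k) K = G′ , ≈ₘ-trans (·-congʳ G′ I+KKᵗ≈addOuter) addOuter·G′≈I , G′-sym
    where
    open DropFirstColumn K
    G₀ = I+KKᵗ-inverse k K₀
    open RankOneUpdate (I+KKᵗ K₀) (proj₁ G₀) (proj₁ (proj₂ G₀)) (proj₂ (proj₂ G₀)) v
    instance
      1+s≢0 : NonZero (1ℚ + s)
      1+s≢0 = pos⇒nonZero (1ℚ + s) {{pos+nonNeg⇒pos 1ℚ s {{nonNegative (subst (0ℚ ≤_) (sym s≡quadForm) (quadForm-I+KKᵗ-nonNeg k K₀ u))}}}}


module Casts where

  open import Data.Nat using (zero; suc) renaming (_+_ to _+ℕ_; _*_ to _*ℕ_)
  open import Data.Integer as ℤ using (ℤ)
  open import Data.Integer.Properties using (pos-+; +-inverseʳ)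
  open import Data.Rational using (ℚ; 0ℚ; 1ℚ; _+_; _*_; -_; _-_; _/_; toℚᵘ; Positive)
  open import Data.Rational.Properties using (toℚᵘ-injective; toℚᵘ-fromℚᵘ; toℚᵘ-homo-+; toℚᵘ-homo-*; normalize-pos; *-zeroˡ; *-distribʳ-+; *-identityˡ)
  open import Data.Rational.Unnormalised as ℚᵘ using (mkℚᵘ; *≡*)
  open import Data.Rational.Unnormalised.Properties using (≃-trans; ≃-sym; +-cong; *-cong)
  open import Data.Rational.Solver using (module +-*-Solver)
  open import Data.Integer.Solver using () renaming (module +-*-Solver to ℤ-Solver)
  open import Relation.Binary.PropositionalEquality
  open ≡-Reasoning

  fromℤ : ℤ → ℚ
  fromℤ i = i / 1

  private
    toℚᵘ-/ : ∀ i d → toℚᵘ (i / suc d) ℚᵘ.≃ mkℚᵘ i d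
    toℚᵘ-/ i d = toℚᵘ-fromℚᵘ (mkℚᵘ i d)

  fromℤ-+ : ∀ i j → fromℤ (i ℤ.+ j) ≡ fromℤ i + fromℤ j
  fromℤ-+ i j = toℚᵘ-injective (≃-trans (toℚᵘ-/ (i ℤ.+ j) 0)
    (≃-sym (≃-trans (toℚᵘ-homo-+ (fromℤ i) (fromℤ j)) (≃-trans (+-cong (toℚᵘ-/ i 0) (toℚᵘ-/ j 0))
      (*≡* (solve 2 (λ i j → (i :* con (ℤ.+ 1) :+ j :* con (ℤ.+ 1)) :* con (ℤ.+ 1) := (i :+ j) :* con (ℤ.+ 1)) refl i j))))))
    where open ℤ-Solver

  fromℤ-neg : ∀ i → fromℤ (ℤ.- i) ≡ - fromℤ i
  fromℤ-neg i = begin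
    fromℤ (ℤ.- i)                        ≡⟨ solve 2 (λ a b → b := (a :+ b) :- a) refl (fromℤ i) (fromℤ (ℤ.- i)) ⟩
    (fromℤ i + fromℤ (ℤ.- i)) - fromℤ i  ≡⟨ cong (_- fromℤ i) (trans (sym (fromℤ-+ i (ℤ.- i))) (cong fromℤ (+-inverseʳ i))) ⟩
    0ℚ - fromℤ i                         ≡⟨ solve 1 (λ a → con 0ℚ :- a := :- a) refl (fromℤ i) ⟩
    - fromℤ i                            ∎
    where open +-*-Solver

  /-*-cancel : ∀ i d → (i / suc d) * fromℤ (ℤ.+ suc d) ≡ fromℤ i
  /-*-cancel i d = toℚᵘ-injective (≃-trans (toℚᵘ-homo-* (i / suc d) (fromℤ (ℤ.+ suc d)))
    (≃-trans (*-cong (toℚᵘ-/ i d) (toℚᵘ-/ (ℤ.+ suc d) 0)) (≃-trans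
      (*≡* (solve 2 (λ i d → (i :* d) :* con (ℤ.+ 1) := i :* (d :* con (ℤ.+ 1))) refl i (ℤ.+ suc d)))
      (≃-sym (toℚᵘ-/ i 0)))))
    where open ℤ-Solver

  ι : ℕ → ℚ
  ι x = fromℤ (ℤ.+ x)

  ι-+ : ∀ x y → ι (x +ℕ y) ≡ ι x + ι y
  ι-+ x y = trans (cong fromℤ (pos-+ x y)) (fromℤ-+ (ℤ.+ x) (ℤ.+ y))

  ι-* : ∀ x y → ι (x *ℕ y) ≡ ι x * ι y
  ι-* zero y = sym (*-zeroˡ (ι y))
  ι-* (suc x) y = begin
    ι (y +ℕ x *ℕ y)       ≡⟨ ι-+ y (x *ℕ y) ⟩
    ι y + ι (x *ℕ y)      ≡⟨ cong (ι y +_) (ι-* x y) ⟩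
    ι y + ι x * ι y       ≡⟨ cong (_+ ι x * ι y) (*-identityˡ (ι y)) ⟨
    1ℚ * ι y + ι x * ι y  ≡⟨ *-distribʳ-+ (ι y) 1ℚ (ι x) ⟨
    (1ℚ + ι x) * ι y      ≡⟨ cong (_* ι y) (ι-+ 1 x) ⟨
    ι (suc x) * ι y       ∎

  ι-pos : ∀ x → Positive (ι (suc x))
  ι-pos x = normalize-pos (suc x) 1


module NatSums where

  open import Defs using (∑)
  open import Data.Nat as ℕ using (zero; suc; _≡ᵇ_; _<_; z<s; s<s; s<s⁻¹)
  open import Data.Nat.Properties as ℕ using ()
  open import Data.Fin using (toℕ)
  open import Data.Rational using (ℚ; 0ℚ; 1ℚ; _+_; _*_)
  open import Data.Rational.Properties using (+-assoc; +-identityˡ; +-identityʳ; *-identityʳ; *-zeroʳ; *-zeroˡ; *-comm; *-distribˡ-+)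
  open import Data.Rational.Solver using (module +-*-Solver)
  open import Relation.Binary.PropositionalEquality
  open ≡-Reasoning
  open +-*-Solver
  open Matrices using (𝟙; ∑-suc)
  open BoolEquality using (≡ᵇ-sym)
  open Casts using (ι; ι-+)

  σ : ℕ → (ℕ → ℚ) → ℚ
  σ zero g = 0ℚ
  σ (suc m) g = g 0 + σ m (λ x → g (suc x))

  ∑≡σ : ∀ m (g : ℕ → ℚ) → ∑ m (λ i → g (toℕ i)) ≡ σ m g
  ∑≡σ zero g = refl
  ∑≡σ (suc m) g = trans (∑-suc m (λ i → g (toℕ i))) (cong (g 0 +_) (∑≡σ m (λ x → g (suc x))))

  σ-cong : ∀ m {g h : ℕ → ℚ} → (∀ x → x < m → g x ≡ h x) → σ m g ≡ σ m h
  σ-cong zero _ = refl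
  σ-cong (suc m) g≡h = cong₂ _+_ (g≡h 0 z<s) (σ-cong m (λ x x<m → g≡h (suc x) (s<s x<m)))

  σ-distrib-+ : ∀ m (g h : ℕ → ℚ) → σ m (λ x → g x + h x) ≡ σ m g + σ m h
  σ-distrib-+ zero g h = refl
  σ-distrib-+ (suc m) g h = trans (cong ((g 0 + h 0) +_) (σ-distrib-+ m _ _))
    (solve 4 (λ a b c d → (a :+ b) :+ (c :+ d) := (a :+ c) :+ (b :+ d)) refl (g 0) (h 0) (σ m (λ x → g (suc x))) (σ m (λ x → h (suc x))))

  *-distribˡ-σ : ∀ m c (g : ℕ → ℚ) → σ m (λ x → c * g x) ≡ c * σ m g
  *-distribˡ-σ zero c g = sym (*-zeroʳ c)
  *-distribˡ-σ (suc m) c g = trans (cong (c * g 0 +_) (*-distribˡ-σ m c _)) (sym (*-distribˡ-+ c (g 0) _))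

  σ-const : ∀ m c → σ m (λ _ → c) ≡ ι m * c
  σ-const zero c = sym (*-zeroˡ c)
  σ-const (suc m) c = begin
    c + σ m (λ _ → c)   ≡⟨ cong (c +_) (σ-const m c) ⟩
    c + ι m * c         ≡⟨ solve 2 (λ c q → c :+ q :* c := (con 1ℚ :+ q) :* c) refl c (ι m) ⟩
    (1ℚ + ι m) * c      ≡⟨ cong (_* c) (ι-+ 1 m) ⟨
    ι (suc m) * c       ∎

  σ-zero : ∀ m → σ m (λ _ → 0ℚ) ≡ 0ℚ
  σ-zero m = trans (σ-const m 0ℚ) (*-zeroʳ (ι m))

  σ-δʳ : ∀ m a (g : ℕ → ℚ) → a < m → σ m (λ x → g x * 𝟙 (x ≡ᵇ a)) ≡ g a
  σ-δʳ (suc m) zero g _ = begin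
    g 0 * 1ℚ + σ m (λ x → g (suc x) * 0ℚ) ≡⟨ cong₂ _+_ (*-identityʳ (g 0)) (trans (σ-cong m (λ x _ → *-zeroʳ (g (suc x)))) (σ-zero m)) ⟩
    g 0 + 0ℚ                              ≡⟨ +-identityʳ (g 0) ⟩
    g 0                                   ∎
  σ-δʳ (suc m) (suc a) g a<m = begin
    g 0 * 0ℚ + σ m (λ x → g (suc x) * 𝟙 (x ≡ᵇ a)) ≡⟨ cong₂ _+_ (*-zeroʳ (g 0)) (σ-δʳ m a (λ x → g (suc x)) (s<s⁻¹ a<m)) ⟩
    0ℚ + g (suc a)                                ≡⟨ +-identityˡ (g (suc a)) ⟩
    g (suc a)                                     ∎

  σ-δˡ : ∀ m a (g : ℕ → ℚ) → a < m → σ m (λ x → 𝟙 (a ≡ᵇ x) * g x) ≡ g a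
  σ-δˡ m a g a<m = trans (σ-cong m (λ x _ → trans (*-comm (𝟙 (a ≡ᵇ x)) (g x)) (cong (λ b → g x * 𝟙 b) (≡ᵇ-sym a x)))) (σ-δʳ m a g a<m)

  σ-split : ∀ a b (g : ℕ → ℚ) → σ (a ℕ.+ b) g ≡ σ a g + σ b (λ x → g (a ℕ.+ x))
  σ-split zero b g = sym (+-identityˡ _)
  σ-split (suc a) b g = trans (cong (g 0 +_) (σ-split a b (λ x → g (suc x)))) (sym (+-assoc (g 0) _ _))

  σ-snoc : ∀ m (g : ℕ → ℚ) → σ (suc m) g ≡ σ m g + g m
  σ-snoc m g = begin
    σ (suc m) g                          ≡⟨ cong (λ t → σ t g) (ℕ.+-comm 1 m) ⟩
    σ (m ℕ.+ 1) g                        ≡⟨ σ-split m 1 g ⟩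
    σ m g + (g (m ℕ.+ 0) + 0ℚ)           ≡⟨ cong (σ m g +_) (trans (+-identityʳ _) (cong g (ℕ.+-identityʳ m))) ⟩
    σ m g + g m                          ∎


module GearIndices (k : ℕ) where

  open import Data.Nat
  open import Data.Nat.Properties
  open import Data.Bool using (Bool; true; false; if_then_else_; _∨_)
  open import Data.Bool.Properties using (∨-comm)
  open import Data.Empty using (⊥; ⊥-elim)
  open import Relation.Nullary using (yes; no)
  open import Relation.Binary.PropositionalEquality
  open import Defs using (cycOff; sEntry; tEntry)
  open BoolEquality

  p : ℕ
  p = suc (suc (suc k))

  next : ℕ → ℕ
  next l = if suc l ≡ᵇ p then 0 else suc l

  data NextView (l : ℕ) : Set where
    wraps : suc l ≡ p → next l ≡ 0 → NextView l
    steps : suc l ≢ p → next l ≡ suc l → NextView l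

  nextView : ∀ l → NextView l
  nextView l with suc l ≟ p
  ... | yes e = wraps e (cong (λ b → if b then 0 else suc l) (≡⇒≡ᵇ-true e))
  ... | no ne = steps ne (cong (λ b → if b then 0 else suc l) (≢⇒≡ᵇ-false ne))

  next<p : ∀ {l} → l < p → next l < p
  next<p {l} l<p with nextView l
  ... | wraps _ e = subst (_< p) (sym e) z<s
  ... | steps ne e = subst (_< p) (sym e) (≤∧≢⇒< l<p ne)

  next≢id : ∀ l → next l ≢ l
  next≢id l eq with nextView l
  ... | wraps w e = 0≢1+n (trans (sym e) (trans eq (suc-injective w)))
  ... | steps _ e = 1+n≢n (trans (sym e) eq)

  next-injective : ∀ {l l′} → next l ≡ next l′ → l ≡ l′
  next-injective {l} {l′} eq with nextView l | nextView l′
  ... | wraps w _ | wraps w′ _ = suc-injective (trans w (sym w′))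
  ... | wraps _ e | steps _ e′ = ⊥-elim (0≢1+n (trans (sym e) (trans eq e′)))
  ... | steps _ e | wraps _ e′ = ⊥-elim (0≢1+n (sym (trans (sym e) (trans eq e′))))
  ... | steps _ e | steps _ e′ = suc-injective (trans (sym e) (trans eq e′))

  -- Here p ≥ 3 is used: two steps around the cycle never return to the start.
  next²≢id : ∀ l → next (next l) ≢ l
  next²≢id l eq with nextView l
  ... | wraps w e with trans (sym (cong next e)) (trans eq (suc-injective w))
  ...   | ()
  next²≢id l eq | steps _ e with nextView (suc l)
  ...   | wraps w e₂ = 0≢1+n (trans (sym e₂) (trans (sym (cong next e)) (trans eq (suc-injective (suc-injective w)))))
  ...   | steps _ e₂ = m≢1+n+m l (sym (trans (sym (trans (cong next e) e₂)) eq))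

  data OffsetView (j l : ℕ) : Set where
    ahead : ∀ e → l ≡ j + e → cycOff p j l ≡ e → OffsetView j l
    behind : ∀ e f → j ≡ l + suc e → suc e + f ≡ p → cycOff p j l ≡ f → OffsetView j l

  offsetView : ∀ j l → j < p → OffsetView j l
  offsetView j l j<p with j ≤? l
  ... | yes j≤l = ahead (l ∸ j) (sym (m+[n∸m]≡n j≤l)) (cong (λ b → if b then l ∸ j else (l + p) ∸ j) (T⇒≡true (≤⇒≤ᵇ j≤l)))
  ... | no j≰l = behind e (p ∸ suc e) j≡ (m+[n∸m]≡n 1+e≤p) cycOff≡
    where
    e = j ∸ suc l
    j≡ : j ≡ l + suc e
    j≡ = trans (sym (m+[n∸m]≡n (≰⇒> j≰l))) (sym (+-suc l e))
    1+e≤p : suc e ≤ p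
    1+e≤p = ≤-trans (m≤n+m (suc e) l) (≤-trans (≤-reflexive (sym j≡)) (<⇒≤ j<p))
    cycOff≡ : cycOff p j l ≡ p ∸ suc e
    cycOff≡ = trans (cong (λ b → if b then l ∸ j else (l + p) ∸ j) (¬T⇒≡false (λ t → j≰l (≤ᵇ⇒≤ j l t))))
                    (trans (cong ((l + p) ∸_) j≡) ([m+n]∸[m+o]≡n∸o l p (suc e)))

  private
    m≡m+n⇒n≡0 : ∀ {m n} → m ≡ m + n → n ≡ 0
    m≡m+n⇒n≡0 {m} {n} eq = sym (+-cancelˡ-≡ m 0 n (trans (+-identityʳ m) eq))

    m+n<1+n⇒m≡0 : ∀ m n → m + n < suc n → m ≡ 0
    m+n<1+n⇒m≡0 zero n _ = refl
    m+n<1+n⇒m≡0 (suc m) n lt = ⊥-elim (m+n≮n m n (s<s⁻¹ lt))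

  cycOff≡0⇒≡ : ∀ j l → j < p → cycOff p j l ≡ 0 → j ≡ l
  cycOff≡0⇒≡ j l j<p c with offsetView j l j<p
  ... | ahead e l≡ c≡ = sym (trans l≡ (trans (cong (j +_) (trans (sym c≡) c)) (+-identityʳ j)))
  ... | behind e f j≡ sum≡p c≡ = ⊥-elim (m+n≮n l (suc e) (subst (_< suc e) j≡ (subst (j <_) p≡1+e j<p)))
    where p≡1+e = trans (sym sum≡p) (trans (cong (suc e +_) (trans (sym c≡) c)) (+-identityʳ (suc e)))

  ≡⇒cycOff≡0 : ∀ j l → j < p → j ≡ l → cycOff p j l ≡ 0
  ≡⇒cycOff≡0 j l j<p j≡l with offsetView j l j<p
  ... | ahead e l≡ c≡ = trans c≡ (m≡m+n⇒n≡0 (trans j≡l l≡))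
  ... | behind e f j≡ _ _ = ⊥-elim (m+1+n≢m l (trans (sym j≡) j≡l))

  cycOff≡p∸1⇒next≡ : ∀ j l → j < p → l < p → cycOff p j l ≡ p ∸ 1 → next l ≡ j
  cycOff≡p∸1⇒next≡ j l j<p l<p c with offsetView j l j<p
  ... | ahead e l≡ c≡ = fromView (nextView l)
    where
    l≡j+[p∸1] = trans l≡ (cong (j +_) (trans (sym c≡) c))
    j≡0 = m+n<1+n⇒m≡0 j (p ∸ 1) (subst (_< p) l≡j+[p∸1] l<p)
    fromView : NextView l → next l ≡ j
    fromView (wraps _ e′) = trans e′ (sym j≡0)
    fromView (steps 1+l≢p _) = ⊥-elim (1+l≢p (cong suc (trans l≡j+[p∸1] (cong (_+ (p ∸ 1)) j≡0))))
  ... | behind e f j≡ sum≡p c≡ = fromView (nextView l)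
    where
    1+e≡1 = +-cancelʳ-≡ (p ∸ 1) (suc e) 1 (trans (cong (suc e +_) (trans (sym c) c≡)) sum≡p)
    j≡1+l = trans j≡ (trans (cong (l +_) 1+e≡1) (+-comm l 1))
    fromView : NextView l → next l ≡ j
    fromView (wraps 1+l≡p _) = ⊥-elim (<-irrefl (trans j≡1+l 1+l≡p) j<p)
    fromView (steps _ e′) = trans e′ (sym j≡1+l)

  next≡⇒cycOff≡p∸1 : ∀ j l → j < p → next l ≡ j → cycOff p j l ≡ p ∸ 1
  next≡⇒cycOff≡p∸1 j l j<p eq with nextView l | offsetView j l j<p
  ... | wraps 1+l≡p e | ahead e′ l≡ c≡ = trans c≡ (trans (sym (trans l≡ (cong (_+ e′) (trans (sym eq) e)))) (suc-injective 1+l≡p))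
  ... | wraps _ e | behind e′ _ j≡ _ _ = ⊥-elim (0≢1+n (trans (sym (trans (sym eq) e)) (trans j≡ (+-suc l e′))))
  ... | steps _ e | ahead e′ l≡ _ = ⊥-elim (m≢1+m+n l (trans l≡ (cong (_+ e′) (trans (sym eq) e))))
  ... | steps _ e | behind e′ f j≡ sum≡p c≡ = trans c≡ (suc-injective (trans (cong (λ x → suc x + f) (sym e′≡0)) sum≡p))
    where e′≡0 = suc-injective (+-cancelˡ-≡ l (suc e′) 1 (trans (sym j≡) (trans (sym eq) (trans e (sym (+-comm l 1))))))

  cycOff≡1⇒next≡ : ∀ j l → j < p → l < p → cycOff p j l ≡ 1 → next j ≡ l
  cycOff≡1⇒next≡ j l j<p l<p c with offsetView j l j<p
  ... | ahead e l≡ c≡ = fromView (nextView j)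
    where
    l≡1+j = trans l≡ (trans (cong (j +_) (trans (sym c≡) c)) (+-comm j 1))
    fromView : NextView j → next j ≡ l
    fromView (wraps 1+j≡p _) = ⊥-elim (<-irrefl (trans l≡1+j 1+j≡p) l<p)
    fromView (steps _ e′) = trans e′ (sym l≡1+j)
  ... | behind e f j≡ sum≡p c≡ = fromView (nextView j)
    where
    f≡1 = trans (sym c≡) c
    p≡2+e = trans (sym sum≡p) (trans (cong (suc e +_) f≡1) (+-comm (suc e) 1))
    l≡0 = m+n<1+n⇒m≡0 l (suc e) (subst (_< suc (suc e)) j≡ (subst (j <_) p≡2+e j<p))
    fromView : NextView j → next j ≡ l
    fromView (wraps _ e′) = trans e′ (sym l≡0)
    fromView (steps 1+j≢p _) = ⊥-elim (1+j≢p (trans (cong suc (trans j≡ (cong (_+ suc e) l≡0))) (sym p≡2+e)))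

  next≡⇒cycOff≡1 : ∀ j l → j < p → next j ≡ l → cycOff p j l ≡ 1
  next≡⇒cycOff≡1 j l j<p eq with nextView j | offsetView j l j<p
  ... | wraps 1+j≡p e | ahead e′ l≡ _ with trans (sym (cong suc (m+n≡0⇒m≡0 j (trans (sym l≡) (trans (sym eq) e))))) 1+j≡p
  ...   | ()
  next≡⇒cycOff≡1 j l j<p eq | wraps 1+j≡p e | behind e′ f j≡ sum≡p c≡ =
    trans c≡ (+-cancelˡ-≡ (suc e′) f 1 (trans sum≡p (trans (sym 1+j≡p) (trans (cong suc (trans j≡ (cong (_+ suc e′) l≡0))) (+-comm 1 (suc e′))))))
    where l≡0 = trans (sym eq) e
  next≡⇒cycOff≡1 j l j<p eq | steps _ e | ahead e′ l≡ c≡ = trans c≡ (sym (+-cancelˡ-≡ j 1 e′ (trans (+-comm j 1) (trans (sym (trans (sym eq) e)) l≡))))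
  next≡⇒cycOff≡1 j l j<p eq | steps _ e | behind e′ _ j≡ _ _ = ⊥-elim (m≢1+m+n j (trans j≡ (cong (_+ suc e′) (trans (sym eq) e))))

  cycOff≡ᵇ0 : ∀ j l → j < p → (cycOff p j l ≡ᵇ 0) ≡ (j ≡ᵇ l)
  cycOff≡ᵇ0 j l j<p = ≡ᵇ-cong-⇔ (cycOff≡0⇒≡ j l j<p) (≡⇒cycOff≡0 j l j<p)

  cycOff≡ᵇ1 : ∀ j l → j < p → l < p → (cycOff p j l ≡ᵇ 1) ≡ (next j ≡ᵇ l)
  cycOff≡ᵇ1 j l j<p l<p = ≡ᵇ-cong-⇔ (cycOff≡1⇒next≡ j l j<p l<p) (next≡⇒cycOff≡1 j l j<p)

  cycOff≡ᵇp∸1 : ∀ j l → j < p → l < p → (cycOff p j l ≡ᵇ p ∸ 1) ≡ (next l ≡ᵇ j)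
  cycOff≡ᵇp∸1 j l j<p l<p = ≡ᵇ-cong-⇔ (cycOff≡p∸1⇒next≡ j l j<p l<p) (next≡⇒cycOff≡p∸1 j l j<p)

  sValue : Bool → Bool → ℕ
  sValue a b = if a ∨ b then 1 else 3

  tValue : Bool → Bool → Bool → ℕ
  tValue a b c = if a then 0 else if b ∨ c then 2 else 4

  sEntry≡sValue : ∀ j l → j < p → l < p → sEntry p j l ≡ sValue (j ≡ᵇ l) (next l ≡ᵇ j)
  sEntry≡sValue j l j<p l<p = cong₂ sValue (cycOff≡ᵇ0 j l j<p) (cycOff≡ᵇp∸1 j l j<p l<p)

  tEntry≡tValue : ∀ j l → j < p → l < p → tEntry p j l ≡ tValue (j ≡ᵇ l) (next j ≡ᵇ l) (next l ≡ᵇ j)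
  tEntry≡tValue j l j<p l<p =
    trans (cong (λ a → tValue a (cycOff p j l ≡ᵇ 1) (cycOff p j l ≡ᵇ p ∸ 1)) (cycOff≡ᵇ0 j l j<p))
          (cong₂ (tValue (j ≡ᵇ l)) (cycOff≡ᵇ1 j l j<p l<p) (cycOff≡ᵇp∸1 j l j<p l<p))

  private
    Disjoint : Bool → Bool → Set
    Disjoint a b = a ≡ true → b ≡ true → ⊥

    sValue-split : ∀ a c → Disjoint a c → sValue a c + 1 ≡ (if a then 0 else 2) + (if c then 0 else 2)
    sValue-split true true a∩c = ⊥-elim (a∩c refl refl)
    sValue-split true false _ = refl
    sValue-split false true _ = refl
    sValue-split false false _ = refl

    tValue-split : ∀ a b c → Disjoint a b → Disjoint a c → Disjoint b c → tValue a b c + 2 ≡ sValue a b + sValue c a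
    tValue-split true true _ a∩b _ _ = ⊥-elim (a∩b refl refl)
    tValue-split true false true _ a∩c _ = ⊥-elim (a∩c refl refl)
    tValue-split true false false _ _ _ = refl
    tValue-split false true true _ _ b∩c = ⊥-elim (b∩c refl refl)
    tValue-split false true false _ _ _ = refl
    tValue-split false false true _ _ _ = refl
    tValue-split false false false _ _ _ = refl

  -- d(rim m, mid l) + d(rim m, hub) = d(rim m, rim l) + d(rim m, rim (l+1))
  sEntry-column : ∀ m l → m < p → l < p →
    sEntry p m l + 1 ≡ (if m ≡ᵇ l then 0 else 2) + (if m ≡ᵇ next l then 0 else 2)
  sEntry-column m l m<p l<p = begin
    sEntry p m l + 1
      ≡⟨ cong (_+ 1) (sEntry≡sValue m l m<p l<p) ⟩
    sValue (m ≡ᵇ l) (next l ≡ᵇ m) + 1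
      ≡⟨ sValue-split (m ≡ᵇ l) (next l ≡ᵇ m) (λ x y → next≢id l (trans (≡ᵇ-true⇒≡ y) (≡ᵇ-true⇒≡ x))) ⟩
    (if m ≡ᵇ l then 0 else 2) + (if next l ≡ᵇ m then 0 else 2)
      ≡⟨ cong (λ b → (if m ≡ᵇ l then 0 else 2) + (if b then 0 else 2)) (≡ᵇ-sym (next l) m) ⟩
    (if m ≡ᵇ l then 0 else 2) + (if m ≡ᵇ next l then 0 else 2) ∎
    where open ≡-Reasoning

  -- d(mid m, mid l) + d(mid m, hub) = d(rim l, mid m) + d(rim (l+1), mid m)
  tEntry-column : ∀ m l → m < p → l < p → tEntry p m l + 2 ≡ sEntry p l m + sEntry p (next l) m
  tEntry-column m l m<p l<p = begin
    tEntry p m l + 2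
      ≡⟨ cong (_+ 2) (tEntry≡tValue m l m<p l<p) ⟩
    tValue (m ≡ᵇ l) (next m ≡ᵇ l) (next l ≡ᵇ m) + 2
      ≡⟨ tValue-split (m ≡ᵇ l) (next m ≡ᵇ l) (next l ≡ᵇ m)
           (λ x y → next≢id m (trans (≡ᵇ-true⇒≡ y) (sym (≡ᵇ-true⇒≡ x))))
           (λ x y → next≢id l (trans (≡ᵇ-true⇒≡ y) (≡ᵇ-true⇒≡ x)))
           (λ x y → next²≢id m (trans (cong next (≡ᵇ-true⇒≡ x)) (≡ᵇ-true⇒≡ y))) ⟩
    sValue (m ≡ᵇ l) (next m ≡ᵇ l) + sValue (next l ≡ᵇ m) (m ≡ᵇ l)
      ≡⟨ cong₂ _+_ (cong (λ b → sValue b (next m ≡ᵇ l)) (≡ᵇ-sym m l))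
                   (cong (sValue (next l ≡ᵇ m)) (≡ᵇ-cong-⇔ {m} {l} {next m} {next l} (cong next) next-injective)) ⟩
    sValue (l ≡ᵇ m) (next m ≡ᵇ l) + sValue (next l ≡ᵇ m) (next m ≡ᵇ next l)
      ≡⟨ cong₂ _+_ (sEntry≡sValue l m l<p m<p) (sEntry≡sValue (next l) m (next<p l<p) m<p) ⟨
    sEntry p l m + sEntry p (next l) m ∎
    where open ≡-Reasoning

  tEntry-sym : ∀ j l → j < p → l < p → tEntry p j l ≡ tEntry p l j
  tEntry-sym j l j<p l<p = begin
    tEntry p j l                                         ≡⟨ tEntry≡tValue j l j<p l<p ⟩
    tValue (j ≡ᵇ l) (next j ≡ᵇ l) (next l ≡ᵇ j)          ≡⟨ cong₂ (λ a b → if a then 0 else if b then 2 else 4) (≡ᵇ-sym j l) (∨-comm (next j ≡ᵇ l) _) ⟩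
    tValue (l ≡ᵇ j) (next l ≡ᵇ j) (next j ≡ᵇ l)          ≡⟨ tEntry≡tValue l j l<p j<p ⟨
    tEntry p l j                                         ∎
    where open ≡-Reasoning


module GearEntries (k : ℕ) where

  open import Data.Nat
  open import Data.Nat.Properties
  open import Data.Bool using (true; false; if_then_else_)
  open import Relation.Nullary using (yes; no)
  open import Relation.Binary.PropositionalEquality
  open import Defs
  open BoolEquality
  open GearIndices k

  n : ℕ
  n = suc p

  2n∸1≡1+p+p : 2 * n ∸ 1 ≡ suc (p + p)
  2n∸1≡1+p+p = trans (cong (λ x → p + suc x) (+-identityʳ p)) (+-suc p p)

  d : ℕ → ℕ → ℕ
  d = dEntryℕ n

  private
    rim<ᵇ : ∀ {j} → j < p → (j <ᵇ p) ≡ true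
    rim<ᵇ j<p = T⇒≡true (<⇒<ᵇ j<p)

    mid<ᵇ : ∀ l → ((p + l) <ᵇ p) ≡ false
    mid<ᵇ l = ¬T⇒≡false (λ t → m+n≮m p l (<ᵇ⇒< (p + l) p t))

  d-hub-rim : ∀ {j} → j < p → d 0 (suc j) ≡ 1
  d-hub-rim j<p rewrite rim<ᵇ j<p = refl

  d-hub-mid : ∀ l → d 0 (suc (p + l)) ≡ 2
  d-hub-mid l rewrite mid<ᵇ l = refl

  d-rim-hub : ∀ {j} → j < p → d (suc j) 0 ≡ 1
  d-rim-hub j<p rewrite rim<ᵇ j<p = refl

  d-mid-hub : ∀ l → d (suc (p + l)) 0 ≡ 2
  d-mid-hub l rewrite mid<ᵇ l = refl

  d-rim-rim : ∀ {j l} → j < p → l < p → d (suc j) (suc l) ≡ (if j ≡ᵇ l then 0 else 2)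
  d-rim-rim j<p l<p rewrite rim<ᵇ j<p | rim<ᵇ l<p = refl

  d-rim-mid : ∀ {j} l → j < p → d (suc j) (suc (p + l)) ≡ sEntry p j l
  d-rim-mid l j<p rewrite rim<ᵇ j<p | mid<ᵇ l | m+n∸m≡n p l = refl

  d-mid-rim : ∀ {j} l → j < p → d (suc (p + l)) (suc j) ≡ sEntry p j l
  d-mid-rim l j<p rewrite rim<ᵇ j<p | mid<ᵇ l | m+n∸m≡n p l = refl

  d-mid-mid : ∀ j l → d (suc (p + j)) (suc (p + l)) ≡ tEntry p j l
  d-mid-mid j l rewrite mid<ᵇ j | mid<ᵇ l | m+n∸m≡n p j | m+n∸m≡n p l = refl

  -- Index 0 is the hub, 1 + j the rim vertex j and 1 + p + l the degree-2 vertex between the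
  -- rim vertices l and next l.
  data Vertex : ℕ → Set where
    hub : Vertex 0
    rim : ∀ j → j < p → Vertex (suc j)
    mid : ∀ l → l < p → Vertex (suc (p + l))

  vertex : ∀ a → a < suc (p + p) → Vertex a
  vertex zero _ = hub
  vertex (suc a) a<N with a <? p
  ... | yes a<p = rim a a<p
  ... | no a≮p = subst Vertex (cong suc p+[a∸p]≡a) (mid (a ∸ p) (+-cancelˡ-< p (a ∸ p) p (subst (_< p + p) (sym p+[a∸p]≡a) (s<s⁻¹ a<N))))
    where p+[a∸p]≡a = m+[n∸m]≡n (≮⇒≥ a≮p)

  d-mid-column : ∀ a l → a < suc (p + p) → l < p → d a (suc (p + l)) + d a 0 ≡ d a (suc l) + d a (suc (next l))
  d-mid-column a l a<N l<p with vertex a a<N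
  ... | hub = trans (cong₂ _+_ (d-hub-mid l) refl) (sym (cong₂ _+_ (d-hub-rim l<p) (d-hub-rim (next<p l<p))))
  ... | rim m m<p = trans (cong₂ _+_ (d-rim-mid l m<p) (d-rim-hub m<p))
                      (trans (sEntry-column m l m<p l<p) (sym (cong₂ _+_ (d-rim-rim m<p l<p) (d-rim-rim m<p (next<p l<p)))))
  ... | mid m m<p = trans (cong₂ _+_ (d-mid-mid m l) (d-mid-hub m))
                      (trans (tEntry-column m l m<p l<p) (sym (cong₂ _+_ (d-mid-rim m l<p) (d-mid-rim m (next<p l<p)))))

  d-sym : ∀ a b → a < suc (p + p) → b < suc (p + p) → d a b ≡ d b a
  d-sym a b a<N b<N with vertex a a<N | vertex b b<N
  ... | hub | hub = refl
  ... | hub | rim j j<p = trans (d-hub-rim j<p) (sym (d-rim-hub j<p))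
  ... | hub | mid l _ = trans (d-hub-mid l) (sym (d-mid-hub l))
  ... | rim j j<p | hub = trans (d-rim-hub j<p) (sym (d-hub-rim j<p))
  ... | mid l _ | hub = trans (d-mid-hub l) (sym (d-hub-mid l))
  ... | rim j j<p | rim l l<p = trans (d-rim-rim j<p l<p) (trans (cong (λ x → if x then 0 else 2) (≡ᵇ-sym j l)) (sym (d-rim-rim l<p j<p)))
  ... | rim j j<p | mid l _ = trans (d-rim-mid l j<p) (sym (d-mid-rim l j<p))
  ... | mid l _ | rim j j<p = trans (d-mid-rim l j<p) (sym (d-rim-mid l j<p))
  ... | mid j j<p | mid l l<p = trans (d-mid-mid j l) (trans (tEntry-sym j l j<p l<p) (sym (d-mid-mid l j)))


module GearFactorization (k : ℕ) where

  open import Defs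
  open import Data.Nat as ℕ using (suc; _≡ᵇ_; _<ᵇ_; _<_; _∸_; z<s; s<s; s≤s)
  open import Data.Nat.Properties as ℕ using ()
  open import Data.Fin using (Fin; toℕ)
  open import Data.Fin.Properties using (toℕ<n)
  open import Data.Rational using (ℚ; 1ℚ; _+_; _*_; -_; _-_)
  open import Data.Rational.Properties using (*-comm)
  open import Data.Rational.Solver using (module +-*-Solver)
  open import Data.Bool using (if_then_else_)
  open import Relation.Binary.PropositionalEquality
  open ≡-Reasoning
  open +-*-Solver
  open BoolEquality
  open Matrices
  open Casts
  open NatSums
  open ShermanMorrison using (I+KKᵗ)
  open GearIndices k
  open GearEntries k

  N : ℕ
  N = 2 ℕ.* n ∸ 1

  dℚ : ℕ → ℕ → ℚ
  dℚ a b = ι (d a b)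

  dℚ-mid-column : ∀ a l → a < suc (p ℕ.+ p) → l < p →
    dℚ a (suc (p ℕ.+ l)) ≡ - dℚ a 0 + dℚ a (suc l) + dℚ a (suc (next l))
  dℚ-mid-column a l a<N l<p = begin
    x                ≡⟨ solve 2 (λ x y → x := (x :+ y) :- y) refl x y ⟩
    (x + y) - y      ≡⟨ cong (_- y) (trans (sym (ι-+ (d a (suc (p ℕ.+ l))) (d a 0))) (trans (cong ι (d-mid-column a l a<N l<p)) (ι-+ (d a (suc l)) (d a (suc (next l)))))) ⟩
    (z + w) - y      ≡⟨ solve 3 (λ z w y → (z :+ w) :- y := :- y :+ z :+ w) refl z w y ⟩
    - y + z + w      ∎
    where
    x = dℚ a (suc (p ℕ.+ l))
    y = dℚ a 0
    z = dℚ a (suc l)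
    w = dℚ a (suc (next l))

  κ : ℕ → ℕ → ℚ
  κ a l = - 𝟙 (a ≡ᵇ 0) + 𝟙 (a ≡ᵇ suc l) + 𝟙 (a ≡ᵇ suc (next l))

  φ : ℕ → ℕ → ℚ
  φ a c = if c <ᵇ n then 𝟙 (a ≡ᵇ c) else κ a (c ∸ n)

  φ-left : ∀ a c → c < n → φ a c ≡ 𝟙 (a ≡ᵇ c)
  φ-left a c c<n = cong (λ t → if t then 𝟙 (a ≡ᵇ c) else κ a (c ∸ n)) (T⇒≡true (ℕ.<⇒<ᵇ c<n))

  φ-mid : ∀ a l → φ a (suc (p ℕ.+ l)) ≡ κ a l
  φ-mid a l = trans (cong (λ t → if t then 𝟙 (a ≡ᵇ suc (p ℕ.+ l)) else κ a (suc (p ℕ.+ l) ∸ n))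
                          (¬T⇒≡false (λ t → ℕ.m+n≮m p l (ℕ.<ᵇ⇒< (p ℕ.+ l) p t))))
                    (cong (κ a) (ℕ.m+n∸m≡n p l))

  σ-*κ : ∀ (g : ℕ → ℚ) l → l < p → σ n (λ b → g b * κ b l) ≡ - g 0 + g (suc l) + g (suc (next l))
  σ-*κ g l l<p = begin
    σ n (λ b → g b * κ b l)
      ≡⟨ σ-cong n (λ b _ → solve 4 (λ g x y z → g :* (:- x :+ y :+ z) := con (- 1ℚ) :* (g :* x) :+ g :* y :+ g :* z) refl (g b) (𝟙 (b ≡ᵇ 0)) (𝟙 (b ≡ᵇ suc l)) (𝟙 (b ≡ᵇ suc (next l)))) ⟩
    σ n (λ b → (- 1ℚ) * (g b * 𝟙 (b ≡ᵇ 0)) + g b * 𝟙 (b ≡ᵇ suc l) + g b * 𝟙 (b ≡ᵇ suc (next l)))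
      ≡⟨ trans (σ-distrib-+ n (λ b → (- 1ℚ) * (g b * 𝟙 (b ≡ᵇ 0)) + g b * 𝟙 (b ≡ᵇ suc l)) (λ b → g b * 𝟙 (b ≡ᵇ suc (next l))))
               (cong (_+ σ n (λ b → g b * 𝟙 (b ≡ᵇ suc (next l)))) (σ-distrib-+ n (λ b → (- 1ℚ) * (g b * 𝟙 (b ≡ᵇ 0))) (λ b → g b * 𝟙 (b ≡ᵇ suc l)))) ⟩
    σ n (λ b → (- 1ℚ) * (g b * 𝟙 (b ≡ᵇ 0))) + σ n (λ b → g b * 𝟙 (b ≡ᵇ suc l)) + σ n (λ b → g b * 𝟙 (b ≡ᵇ suc (next l)))
      ≡⟨ cong₂ _+_ (cong₂ _+_ (trans (*-distribˡ-σ n (- 1ℚ) (λ b → g b * 𝟙 (b ≡ᵇ 0))) (cong ((- 1ℚ) *_) (σ-δʳ n 0 g z<s))) (σ-δʳ n (suc l) g (s<s l<p)))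
                   (σ-δʳ n (suc (next l)) g (s<s (next<p l<p))) ⟩
    (- 1ℚ) * g 0 + g (suc l) + g (suc (next l))
      ≡⟨ solve 3 (λ a b c → con (- 1ℚ) :* a :+ b :+ c := :- a :+ b :+ c) refl (g 0) (g (suc l)) (g (suc (next l))) ⟩
    - g 0 + g (suc l) + g (suc (next l)) ∎

  F : Matrix n N
  F a c = φ (toℕ a) (toℕ c)

  M : Matrix n n
  M a b = dℚ (toℕ a) (toℕ b)

  K : Matrix n p
  K a l = κ (toℕ a) (toℕ l)

  E : Matrix n N
  E a c = dℚ (toℕ a) (toℕ c)

  D : Matrix N N
  D = gearD n

  toℕ<1+p+p : ∀ (c : Fin N) → toℕ c < suc (p ℕ.+ p)
  toℕ<1+p+p c = subst (toℕ c <_) 2n∸1≡1+p+p (toℕ<n c)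

  <n⇒<1+p+p : ∀ {a} → a < n → a < suc (p ℕ.+ p)
  <n⇒<1+p+p a<n = ℕ.≤-trans a<n (s≤s (ℕ.m≤m+n p p))

  dℚ-sym : ∀ a b → a < suc (p ℕ.+ p) → b < suc (p ℕ.+ p) → dℚ a b ≡ dℚ b a
  dℚ-sym a b a<N b<N = cong ι (d-sym a b a<N b<N)

  D-sym : Symmetric D
  D-sym a b = dℚ-sym (toℕ b) (toℕ a) (toℕ<1+p+p b) (toℕ<1+p+p a)

  M-sym : Symmetric M
  M-sym a b = dℚ-sym (toℕ b) (toℕ a) (<n⇒<1+p+p (toℕ<n b)) (<n⇒<1+p+p (toℕ<n a))

  M·F≈E : (M · F) ≈ₘ E
  M·F≈E a c = trans (∑≡σ n (λ b → dℚ (toℕ a) b * φ b (toℕ c))) (byVertex (vertex (toℕ c) (toℕ<1+p+p c)))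
    where
    left : ∀ x → x < n → σ n (λ b → dℚ (toℕ a) b * φ b x) ≡ dℚ (toℕ a) x
    left x x<n = trans (σ-cong n (λ b _ → cong (dℚ (toℕ a) b *_) (φ-left b x x<n))) (σ-δʳ n x (dℚ (toℕ a)) x<n)
    byVertex : ∀ {x} → Vertex x → σ n (λ b → dℚ (toℕ a) b * φ b x) ≡ dℚ (toℕ a) x
    byVertex hub = left 0 z<s
    byVertex (rim j j<p) = left (suc j) (s<s j<p)
    byVertex (mid l l<p) = begin
      σ n (λ b → dℚ (toℕ a) b * φ b (suc (p ℕ.+ l))) ≡⟨ σ-cong n (λ b _ → cong (dℚ (toℕ a) b *_) (φ-mid b l)) ⟩
      σ n (λ b → dℚ (toℕ a) b * κ b l)               ≡⟨ σ-*κ (dℚ (toℕ a)) l l<p ⟩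
      - dℚ (toℕ a) 0 + dℚ (toℕ a) (suc l) + dℚ (toℕ a) (suc (next l))
                                                     ≡⟨ dℚ-mid-column (toℕ a) l (<n⇒<1+p+p (toℕ<n a)) l<p ⟨
      dℚ (toℕ a) (suc (p ℕ.+ l))                      ∎

  Fᵗ·E≈D : (transpose F · E) ≈ₘ D
  Fᵗ·E≈D a c = trans (∑≡σ n (λ b → φ b (toℕ a) * dℚ b (toℕ c))) (byVertex (toℕ<1+p+p a) (vertex (toℕ a) (toℕ<1+p+p a)))
    where
    c′ = toℕ c
    c′<N = toℕ<1+p+p c
    left : ∀ x → x < n → σ n (λ b → φ b x * dℚ b c′) ≡ dℚ x c′
    left x x<n = trans (σ-cong n (λ b _ → trans (cong (_* dℚ b c′) (φ-left b x x<n)) (*-comm (𝟙 (b ≡ᵇ x)) (dℚ b c′)))) (σ-δʳ n x (λ b → dℚ b c′) x<n)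
    byVertex : ∀ {x} → x < suc (p ℕ.+ p) → Vertex x → σ n (λ b → φ b x * dℚ b c′) ≡ dℚ x c′
    byVertex _ hub = left 0 z<s
    byVertex _ (rim j j<p) = left (suc j) (s<s j<p)
    byVertex x<N (mid l l<p) = begin
      σ n (λ b → φ b (suc (p ℕ.+ l)) * dℚ b c′)
        ≡⟨ σ-cong n (λ b _ → trans (cong (_* dℚ b c′) (φ-mid b l)) (*-comm (κ b l) (dℚ b c′))) ⟩
      σ n (λ b → dℚ b c′ * κ b l)
        ≡⟨ σ-*κ (λ b → dℚ b c′) l l<p ⟩
      - dℚ 0 c′ + dℚ (suc l) c′ + dℚ (suc (next l)) c′
        ≡⟨ cong₂ _+_ (cong₂ _+_ (cong -_ (dℚ-sym 0 c′ z<s c′<N)) (dℚ-sym (suc l) c′ (<n⇒<1+p+p (s<s l<p)) c′<N))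
                     (dℚ-sym (suc (next l)) c′ (<n⇒<1+p+p (s<s (next<p l<p))) c′<N) ⟩
      - dℚ c′ 0 + dℚ c′ (suc l) + dℚ c′ (suc (next l))
        ≡⟨ dℚ-mid-column c′ l c′<N l<p ⟨
      dℚ c′ (suc (p ℕ.+ l))
        ≡⟨ dℚ-sym c′ (suc (p ℕ.+ l)) c′<N x<N ⟩
      dℚ (suc (p ℕ.+ l)) c′ ∎

  D≈FᵗMF : D ≈ₘ (transpose F · (M · F))
  D≈FᵗMF = ≈ₘ-sym (≈ₘ-trans (·-congˡ (transpose F) M·F≈E) Fᵗ·E≈D)

  F·Fᵗ≈I+KKᵗ : (F · transpose F) ≈ₘ I+KKᵗ K
  F·Fᵗ≈I+KKᵗ a b = begin
    ∑ N (λ c → φ a′ (toℕ c) * φ b′ (toℕ c))                              ≡⟨ ∑≡σ N (λ c → φ a′ c * φ b′ c) ⟩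
    σ N (λ c → φ a′ c * φ b′ c)                                          ≡⟨ cong (λ t → σ t (λ c → φ a′ c * φ b′ c)) 2n∸1≡1+p+p ⟩
    σ (n ℕ.+ p) (λ c → φ a′ c * φ b′ c)                                  ≡⟨ σ-split n p (λ c → φ a′ c * φ b′ c) ⟩
    σ n (λ c → φ a′ c * φ b′ c) + σ p (λ l → φ a′ (n ℕ.+ l) * φ b′ (n ℕ.+ l))
      ≡⟨ cong₂ _+_ (trans (σ-cong n (λ c c<n → trans (cong₂ _*_ (φ-left a′ c c<n) (φ-left b′ c c<n)) (*-comm (𝟙 (a′ ≡ᵇ c)) (𝟙 (b′ ≡ᵇ c)))))
                          (σ-δˡ n b′ (λ c → 𝟙 (a′ ≡ᵇ c)) (toℕ<n b)))
                   (σ-cong p (λ l _ → cong₂ _*_ (φ-mid a′ l) (φ-mid b′ l))) ⟩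
    𝟙 (a′ ≡ᵇ b′) + σ p (λ l → κ a′ l * κ b′ l)                           ≡⟨ cong (𝟙 (a′ ≡ᵇ b′) +_) (∑≡σ p (λ l → κ a′ l * κ b′ l)) ⟨
    I+KKᵗ K a b                                                           ∎
    where
    a′ = toℕ a
    b′ = toℕ b


module StarInverse (k : ℕ) where

  open import Defs
  open import Data.Nat as ℕ using (zero; suc; _≡ᵇ_; _<_; s<s⁻¹)
  open import Data.Fin using (toℕ)
  open import Data.Fin.Properties using (toℕ<n)
  open import Data.Rational using (ℚ; 0ℚ; 1ℚ; ½; _+_; _*_; -_; _-_; 1/_; NonZero)
  open import Data.Rational.Properties using (*-inverseʳ; pos⇒nonZero; *-zeroˡ; *-identityˡ; +-identityˡ)
  open import Data.Rational.Solver using (module +-*-Solver)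
  open import Relation.Binary.PropositionalEquality
  open ≡-Reasoning
  open +-*-Solver
  open BoolEquality
  open Matrices
  open Casts
  open NatSums
  open GearIndices k
  open GearEntries k
  open GearFactorization k

  two : ℚ
  two = ι 2

  P : ℚ
  P = ι p

  instance
    P≢0 : NonZero P
    P≢0 = pos⇒nonZero P {{ι-pos (suc (suc k))}}

  P⁻¹ : ℚ
  P⁻¹ = 1/ P

  P*P⁻¹≡1 : P * P⁻¹ ≡ 1ℚ
  P*P⁻¹≡1 = *-inverseʳ P

  dℚ-hub-rim : ∀ {x} → x < p → dℚ 0 (suc x) ≡ 1ℚ
  dℚ-hub-rim x<p = cong ι (d-hub-rim x<p)

  dℚ-rim-hub : ∀ {x} → x < p → dℚ (suc x) 0 ≡ 1ℚ
  dℚ-rim-hub x<p = cong ι (d-rim-hub x<p)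

  dℚ-rim-rim : ∀ {i x} → i < p → x < p → dℚ (suc i) (suc x) ≡ two - two * 𝟙 (i ≡ᵇ x)
  dℚ-rim-rim {i} {x} i<p x<p = trans (cong ι (d-rim-rim i<p x<p)) (byValue (i ≡ᵇ x))
    where
    open import Data.Bool using (true; false; if_then_else_)
    byValue : ∀ b → ι (if b then 0 else 2) ≡ two - two * 𝟙 b
    byValue true = refl
    byValue false = refl

  hubRow : ∀ (y : ℕ → ℚ) → σ n (λ b → dℚ 0 b * y b) ≡ σ p (λ x → y (suc x))
  hubRow y = begin
    0ℚ * y 0 + σ p (λ x → dℚ 0 (suc x) * y (suc x)) ≡⟨ cong₂ _+_ (*-zeroˡ (y 0)) (σ-cong p (λ x x<p → trans (cong (_* y (suc x)) (dℚ-hub-rim x<p)) (*-identityˡ (y (suc x))))) ⟩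
    0ℚ + σ p (λ x → y (suc x))                      ≡⟨ +-identityˡ _ ⟩
    σ p (λ x → y (suc x))                           ∎

  rimRow : ∀ i (y : ℕ → ℚ) → i < p →
    σ n (λ b → dℚ (suc i) b * y b) ≡ y 0 + (two * σ p (λ x → y (suc x)) - two * y (suc i))
  rimRow i y i<p = begin
    dℚ (suc i) 0 * y 0 + σ p (λ x → dℚ (suc i) (suc x) * y (suc x))
      ≡⟨ cong₂ _+_ (trans (cong (_* y 0) (dℚ-rim-hub i<p)) (*-identityˡ (y 0)))
                   (σ-cong p (λ x x<p → trans (cong (_* y (suc x)) (dℚ-rim-rim i<p x<p))
                     (solve 3 (λ t e v → (t :- t :* e) :* v := t :* v :+ (:- t) :* (e :* v)) refl two (𝟙 (i ≡ᵇ x)) (y (suc x))))) ⟩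
    y 0 + σ p (λ x → two * y (suc x) + (- two) * (𝟙 (i ≡ᵇ x) * y (suc x)))
      ≡⟨ cong (y 0 +_) (trans (σ-distrib-+ p (λ x → two * y (suc x)) (λ x → (- two) * (𝟙 (i ≡ᵇ x) * y (suc x)))) (cong₂ _+_ (*-distribˡ-σ p two (λ x → y (suc x))) (trans (*-distribˡ-σ p (- two) (λ x → 𝟙 (i ≡ᵇ x) * y (suc x))) (cong ((- two) *_) (σ-δˡ p i (λ x → y (suc x)) i<p))))) ⟩
    y 0 + (two * σ p (λ x → y (suc x)) + (- two) * y (suc i))
      ≡⟨ cong (λ e → y 0 + (two * σ p (λ x → y (suc x)) + e)) (solve 2 (λ t v → (:- t) :* v := :- (t :* v)) refl two (y (suc i))) ⟩
    y 0 + (two * σ p (λ x → y (suc x)) - two * y (suc i)) ∎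

  σ-const+δ : ∀ c c′ j → j < p → σ p (λ x → c + c′ * 𝟙 (x ≡ᵇ j)) ≡ P * c + c′
  σ-const+δ c c′ j j<p = begin
    σ p (λ x → c + c′ * 𝟙 (x ≡ᵇ j))           ≡⟨ σ-distrib-+ p (λ _ → c) (λ x → c′ * 𝟙 (x ≡ᵇ j)) ⟩
    σ p (λ _ → c) + σ p (λ x → c′ * 𝟙 (x ≡ᵇ j)) ≡⟨ cong₂ _+_ (σ-const p c) (σ-δʳ p j (λ _ → c′) j<p) ⟩
    P * c + c′                                ∎

  -- M is the distance matrix of the star K₁,ₚ formed by the hub and the rim.
  μ : ℕ → ℕ → ℚ
  μ zero zero = two * P⁻¹ - two
  μ zero (suc _) = P⁻¹
  μ (suc _) zero = P⁻¹
  μ (suc i) (suc j) = P⁻¹ * ½ + (- ½) * 𝟙 (i ≡ᵇ j)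

  μ-sym : ∀ a b → μ a b ≡ μ b a
  μ-sym zero zero = refl
  μ-sym zero (suc b) = refl
  μ-sym (suc a) zero = refl
  μ-sym (suc a) (suc b) = cong (λ t → P⁻¹ * ½ + (- ½) * 𝟙 t) (≡ᵇ-sym a b)

  M·μ : ∀ a b → a < n → b < n → σ n (λ c → dℚ a c * μ c b) ≡ 𝟙 (a ≡ᵇ b)
  M·μ zero zero _ _ = begin
    σ n (λ c → dℚ 0 c * μ c 0) ≡⟨ hubRow (λ c → μ c 0) ⟩
    σ p (λ _ → P⁻¹)            ≡⟨ σ-const p P⁻¹ ⟩
    P * P⁻¹                    ≡⟨ P*P⁻¹≡1 ⟩
    1ℚ                         ∎
  M·μ zero (suc j) _ 1+j<n = begin
    σ n (λ c → dℚ 0 c * μ c (suc j)) ≡⟨ hubRow (λ c → μ c (suc j)) ⟩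
    σ p (λ x → P⁻¹ * ½ + (- ½) * 𝟙 (x ≡ᵇ j)) ≡⟨ σ-const+δ (P⁻¹ * ½) (- ½) j (s<s⁻¹ 1+j<n) ⟩
    P * (P⁻¹ * ½) + (- ½)                    ≡⟨ solve 2 (λ P Q → P :* (Q :* con ½) :+ con (- ½) := (P :* Q :- con 1ℚ) :* con ½) refl P P⁻¹ ⟩
    (P * P⁻¹ - 1ℚ) * ½                       ≡⟨ cong (λ e → (e - 1ℚ) * ½) P*P⁻¹≡1 ⟩
    (1ℚ - 1ℚ) * ½                            ≡⟨⟩
    0ℚ                                       ∎
  M·μ (suc i) zero 1+i<n _ = begin
    σ n (λ c → dℚ (suc i) c * μ c 0)       ≡⟨ rimRow i (λ c → μ c 0) (s<s⁻¹ 1+i<n) ⟩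
    (two * P⁻¹ - two) + (two * σ p (λ _ → P⁻¹) - two * P⁻¹) ≡⟨ cong (λ e → (two * P⁻¹ - two) + (two * e - two * P⁻¹)) (σ-const p P⁻¹) ⟩
    (two * P⁻¹ - two) + (two * (P * P⁻¹) - two * P⁻¹)       ≡⟨ cong (λ e → (two * P⁻¹ - two) + (two * e - two * P⁻¹)) P*P⁻¹≡1 ⟩
    (two * P⁻¹ - two) + (two * 1ℚ - two * P⁻¹)              ≡⟨ solve 1 (λ Q → (con two :* Q :- con two) :+ (con two :* con 1ℚ :- con two :* Q) := con 0ℚ) refl P⁻¹ ⟩
    0ℚ                                                      ∎
  M·μ (suc i) (suc j) 1+i<n 1+j<n = begin
    σ n (λ c → dℚ (suc i) c * μ c (suc j))
      ≡⟨ rimRow i (λ c → μ c (suc j)) (s<s⁻¹ 1+i<n) ⟩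
    P⁻¹ + (two * σ p (λ x → P⁻¹ * ½ + (- ½) * 𝟙 (x ≡ᵇ j)) - two * (P⁻¹ * ½ + (- ½) * δᵢⱼ))
      ≡⟨ cong (λ e → P⁻¹ + (two * e - two * (P⁻¹ * ½ + (- ½) * δᵢⱼ))) (σ-const+δ (P⁻¹ * ½) (- ½) j (s<s⁻¹ 1+j<n)) ⟩
    P⁻¹ + (two * (P * (P⁻¹ * ½) + (- ½)) - two * (P⁻¹ * ½ + (- ½) * δᵢⱼ))
      ≡⟨ solve 3 (λ P Q e → Q :+ (con two :* (P :* (Q :* con ½) :+ con (- ½)) :- con two :* (Q :* con ½ :+ con (- ½) :* e)) := P :* Q :- con 1ℚ :+ e) refl P P⁻¹ δᵢⱼ ⟩
    P * P⁻¹ - 1ℚ + δᵢⱼ ≡⟨ cong (λ e → e - 1ℚ + δᵢⱼ) P*P⁻¹≡1 ⟩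
    1ℚ - 1ℚ + δᵢⱼ      ≡⟨ +-identityˡ δᵢⱼ ⟩
    δᵢⱼ                ∎
    where δᵢⱼ = 𝟙 (i ≡ᵇ j)

  M⁻¹ : Matrix n n
  M⁻¹ a b = μ (toℕ a) (toℕ b)

  M·M⁻¹≈I : (M · M⁻¹) ≈ₘ δ
  M·M⁻¹≈I a b = trans (∑≡σ n (λ c → dℚ (toℕ a) c * μ c (toℕ b))) (M·μ (toℕ a) (toℕ b) (toℕ<n a) (toℕ<n b))

  M⁻¹-sym : Symmetric M⁻¹
  M⁻¹-sym a b = μ-sym (toℕ b) (toℕ a)


module GearBlockVectors (k : ℕ) where

  open import Defs
  open import Data.Nat as ℕ using (zero; suc; _≡ᵇ_; _<_; z<s; s<s; s<s⁻¹)
  open import Data.Nat.Properties as ℕ using ()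
  open import Data.Fin using (Fin; toℕ)
  open import Data.Fin.Properties using (toℕ<n)
  open import Data.Rational using (ℚ; 0ℚ; 1ℚ; _+_; _*_; -_; _-_)
  open import Data.Rational.Properties using (*-comm; +-comm; *-identityʳ)
  open import Data.Rational.Solver using (module +-*-Solver)
  open import Data.Bool using (if_then_else_)
  open import Data.Empty using (⊥-elim)
  open import Function using (_∘_)
  open import Relation.Binary.PropositionalEquality
  open ≡-Reasoning
  open +-*-Solver
  open Matrices
  open Casts
  open NatSums
  open GearIndices k
  open GearEntries k
  open GearFactorization k
  open StarInverse k

  σ-next : ∀ (g : ℕ → ℚ) → σ p (g ∘ next) ≡ σ p g
  σ-next g = begin
    σ (suc (p ℕ.∸ 1)) (g ∘ next)                ≡⟨ σ-snoc (p ℕ.∸ 1) (g ∘ next) ⟩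
    σ (p ℕ.∸ 1) (g ∘ next) + g (next (p ℕ.∸ 1)) ≡⟨ cong₂ _+_ (σ-cong (p ℕ.∸ 1) (λ x x<p∸1 → cong g (next-below x x<p∸1))) (cong g next-last) ⟩
    σ (p ℕ.∸ 1) (g ∘ suc) + g 0                 ≡⟨ +-comm _ (g 0) ⟩
    σ p g                                       ∎
    where
    next-below : ∀ x → x < p ℕ.∸ 1 → next x ≡ suc x
    next-below x x<p∸1 with nextView x
    ... | wraps 1+x≡p _ = ⊥-elim (ℕ.<-irrefl (ℕ.suc-injective 1+x≡p) x<p∸1)
    ... | steps _ e = e
    next-last : next (p ℕ.∸ 1) ≡ 0
    next-last with nextView (p ℕ.∸ 1)
    ... | wraps _ e = e
    ... | steps 1+p∸1≢p _ = ⊥-elim (1+p∸1≢p refl)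

  hubRim : ℚ → ℚ → ℕ → ℚ
  hubRim a b zero = a
  hubRim a b (suc _) = b

  σ-κ : ∀ a → a < n → σ p (κ a) ≡ hubRim (- P) two a
  σ-κ zero _ = trans (σ-const p (- 1ℚ)) (solve 1 (λ P → P :* con (- 1ℚ) := :- P) refl P)
  σ-κ (suc j) 1+j<n = begin
    σ p (λ l → - 0ℚ + 𝟙 (j ≡ᵇ l) + 𝟙 (j ≡ᵇ next l))
      ≡⟨ σ-cong p (λ l _ → solve 2 (λ a b → :- con 0ℚ :+ a :+ b := a :+ b) refl (𝟙 (j ≡ᵇ l)) (𝟙 (j ≡ᵇ next l))) ⟩
    σ p (λ l → 𝟙 (j ≡ᵇ l) + 𝟙 (j ≡ᵇ next l))
      ≡⟨ σ-distrib-+ p (λ l → 𝟙 (j ≡ᵇ l)) (λ l → 𝟙 (j ≡ᵇ next l)) ⟩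
    σ p (λ l → 𝟙 (j ≡ᵇ l)) + σ p (λ l → 𝟙 (j ≡ᵇ next l))
      ≡⟨ cong (σ p (λ l → 𝟙 (j ≡ᵇ l)) +_) (σ-next (λ l → 𝟙 (j ≡ᵇ l))) ⟩
    σ p (λ l → 𝟙 (j ≡ᵇ l)) + σ p (λ l → 𝟙 (j ≡ᵇ l))
      ≡⟨ cong₂ _+_ (indicator-sum) (indicator-sum) ⟩
    1ℚ + 1ℚ ∎
    where
    indicator-sum = trans (σ-cong p (λ l _ → sym (*-identityʳ (𝟙 (j ≡ᵇ l))))) (σ-δˡ p j (λ _ → 1ℚ) (s<s⁻¹ 1+j<n))

  select : ℚ → ℚ → ℚ → Blk → ℚ
  select a b c b0 = a
  select a b c b1 = b
  select a b c b2 = c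

  blockVector : ℚ → ℚ → ℚ → ℕ → ℚ
  blockVector a b c x = select a b c (blk n x)

  blockVector-rim : ∀ a b c j → j < p → blockVector a b c (suc j) ≡ b
  blockVector-rim a b c j j<p = cong (λ t → select a b c (if t then b1 else b2)) (BoolEquality.T⇒≡true (ℕ.<⇒<ᵇ j<p))

  blockVector-mid : ∀ a b c l → blockVector a b c (suc (p ℕ.+ l)) ≡ c
  blockVector-mid a b c l = cong (λ t → select a b c (if t then b1 else b2)) (BoolEquality.¬T⇒≡false (λ t → ℕ.m+n≮m p l (ℕ.<ᵇ⇒< (p ℕ.+ l) p t)))

  module BlockVector (c₀ c₁ c₂ : ℚ) where

    x₀ x₁ t₀ t₁ : ℚ
    x₀ = c₀ - P * c₂
    x₁ = c₁ + two * c₂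
    t₀ = P * x₁
    t₁ = x₀ + (two * P - two) * x₁

    y : Vector N
    y c = blockVector c₀ c₁ c₂ (toℕ c)

    F·y : ∀ a → (F ·ᵥ y) a ≡ hubRim x₀ x₁ (toℕ a)
    F·y a = begin
      (F ·ᵥ y) a                         ≡⟨ ∑≡σ N (λ c → φ a′ c * blockVector c₀ c₁ c₂ c) ⟩
      σ N (λ c → φ a′ c * y′ c)          ≡⟨ cong (λ t → σ t (λ c → φ a′ c * y′ c)) 2n∸1≡1+p+p ⟩
      σ (n ℕ.+ p) (λ c → φ a′ c * y′ c)  ≡⟨ σ-split n p (λ c → φ a′ c * y′ c) ⟩
      σ n (λ c → φ a′ c * y′ c) + σ p (λ l → φ a′ (n ℕ.+ l) * y′ (n ℕ.+ l))
        ≡⟨ cong₂ _+_ (trans (σ-cong n (λ c c<n → cong (_* y′ c) (φ-left a′ c c<n))) (σ-δˡ n a′ y′ (toℕ<n a)))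
                     (σ-cong p (λ l _ → trans (cong₂ _*_ (φ-mid a′ l) (blockVector-mid c₀ c₁ c₂ l)) (*-comm (κ a′ l) c₂))) ⟩
      y′ a′ + σ p (λ l → c₂ * κ a′ l)    ≡⟨ cong (y′ a′ +_) (trans (*-distribˡ-σ p c₂ (κ a′)) (cong (c₂ *_) (σ-κ a′ (toℕ<n a)))) ⟩
      y′ a′ + c₂ * hubRim (- P) two a′   ≡⟨ byVertex a′ (toℕ<n a) ⟩
      hubRim x₀ x₁ a′                    ∎
      where
      a′ = toℕ a
      y′ = blockVector c₀ c₁ c₂
      byVertex : ∀ b → b < n → y′ b + c₂ * hubRim (- P) two b ≡ hubRim x₀ x₁ b
      byVertex zero _ = solve 3 (λ c₀ c₂ P → c₀ :+ c₂ :* (:- P) := c₀ :- P :* c₂) refl c₀ c₂ P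
      byVertex (suc j) 1+j<n = trans (cong (_+ c₂ * two) (blockVector-rim c₀ c₁ c₂ j (s<s⁻¹ 1+j<n))) (solve 2 (λ c₁ c₂ → c₁ :+ c₂ :* con two := c₁ :+ con two :* c₂) refl c₁ c₂)

    M·hubRim : ∀ a → (M ·ᵥ (λ b → hubRim x₀ x₁ (toℕ b))) a ≡ hubRim t₀ t₁ (toℕ a)
    M·hubRim a = trans (∑≡σ n (λ b → dℚ (toℕ a) b * hubRim x₀ x₁ b)) (byRow (toℕ a) (toℕ<n a))
      where
      byRow : ∀ b → b < n → σ n (λ c → dℚ b c * hubRim x₀ x₁ c) ≡ hubRim t₀ t₁ b
      byRow zero _ = trans (hubRow (hubRim x₀ x₁)) (σ-const p x₁)
      byRow (suc i) 1+i<n = begin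
        σ n (λ c → dℚ (suc i) c * hubRim x₀ x₁ c)  ≡⟨ rimRow i (hubRim x₀ x₁) (s<s⁻¹ 1+i<n) ⟩
        x₀ + (two * σ p (λ _ → x₁) - two * x₁)     ≡⟨ cong (λ e → x₀ + (two * e - two * x₁)) (σ-const p x₁) ⟩
        x₀ + (two * (P * x₁) - two * x₁)           ≡⟨ solve 3 (λ x₀ x₁ P → x₀ :+ (con two :* (P :* x₁) :- con two :* x₁) := x₀ :+ (con two :* P :- con two) :* x₁) refl x₀ x₁ P ⟩
        t₁                                         ∎

    Fᵗ·hubRim : ∀ c → (transpose F ·ᵥ (λ b → hubRim t₀ t₁ (toℕ b))) c ≡ blockVector t₀ t₁ (two * t₁ - t₀) (toℕ c)
    Fᵗ·hubRim c = trans (∑≡σ n (λ b → φ b (toℕ c) * hubRim t₀ t₁ b)) (byVertex (vertex (toℕ c) (toℕ<1+p+p c)))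
      where
      left : ∀ x → x < n → σ n (λ b → φ b x * hubRim t₀ t₁ b) ≡ hubRim t₀ t₁ x
      left x x<n = trans (σ-cong n (λ b _ → trans (cong (_* hubRim t₀ t₁ b) (φ-left b x x<n)) (*-comm (𝟙 (b ≡ᵇ x)) (hubRim t₀ t₁ b)))) (σ-δʳ n x (hubRim t₀ t₁) x<n)
      byVertex : ∀ {x} → Vertex x → σ n (λ b → φ b x * hubRim t₀ t₁ b) ≡ blockVector t₀ t₁ (two * t₁ - t₀) x
      byVertex hub = left 0 z<s
      byVertex (rim j j<p) = trans (left (suc j) (s<s j<p)) (sym (blockVector-rim t₀ t₁ (two * t₁ - t₀) j j<p))
      byVertex (mid l l<p) = begin
        σ n (λ b → φ b (suc (p ℕ.+ l)) * hubRim t₀ t₁ b) ≡⟨ σ-cong n (λ b _ → trans (cong (_* hubRim t₀ t₁ b) (φ-mid b l)) (*-comm (κ b l) (hubRim t₀ t₁ b))) ⟩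
        σ n (λ b → hubRim t₀ t₁ b * κ b l)               ≡⟨ σ-*κ (hubRim t₀ t₁) l l<p ⟩
        - t₀ + t₁ + t₁                                   ≡⟨ solve 2 (λ a b → :- a :+ b :+ b := con two :* b :- a) refl t₀ t₁ ⟩
        two * t₁ - t₀                                    ≡⟨ blockVector-mid t₀ t₁ (two * t₁ - t₀) l ⟨
        blockVector t₀ t₁ (two * t₁ - t₀) (suc (p ℕ.+ l)) ∎

    D·y : ∀ c → (D ·ᵥ y) c ≡ blockVector t₀ t₁ (two * t₁ - t₀) (toℕ c)
    D·y c = begin
      (D ·ᵥ y) c                                          ≡⟨ ·ᵥ-congˡ y D≈FᵗMF c ⟩
      ((transpose F · (M · F)) ·ᵥ y) c                    ≡⟨ ·ᵥ-assoc (transpose F) (M · F) y c ⟩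
      (transpose F ·ᵥ ((M · F) ·ᵥ y)) c                   ≡⟨ ·ᵥ-congʳ (transpose F) (λ a → trans (·ᵥ-assoc M F y a) (trans (·ᵥ-congʳ M F·y a) (M·hubRim a))) c ⟩
      (transpose F ·ᵥ (λ b → hubRim t₀ t₁ (toℕ b))) c     ≡⟨ Fᵗ·hubRim c ⟩
      blockVector t₀ t₁ (two * t₁ - t₀) (toℕ c)           ∎


module GearOnes (k : ℕ) where

  open import Defs
  open import Data.Nat as ℕ using (_∸_)
  import Data.Nat.Solver as ℕ-Solver
  open import Data.Nat.Properties as ℕ using ()
  open import Data.Integer as ℤ using (ℤ)
  open import Data.Fin using (toℕ)
  open import Data.Rational using (ℚ; 0ℚ; 1ℚ; _+_; _*_; -_; _-_; 1/_; NonZero)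
  open import Data.Rational.Properties using (*-inverseʳ; pos⇒nonZero; *-identityˡ; *-assoc)
  open import Data.Rational.Solver using (module +-*-Solver)
  open import Relation.Binary.PropositionalEquality
  open ≡-Reasoning
  open +-*-Solver
  open Casts
  open GearIndices k
  open GearEntries k
  open GearFactorization k
  open StarInverse k
  open GearBlockVectors k

  Q : ℚ
  Q = ι (n ℕ.+ 4)

  instance
    Q≢0 : NonZero Q
    Q≢0 = pos⇒nonZero Q {{ι-pos (p ℕ.+ 4)}}

  Q⁻¹ : ℚ
  Q⁻¹ = 1/ Q

  [P+5]*Q⁻¹≡1 : ((1ℚ + P) + ι 4) * Q⁻¹ ≡ 1ℚ
  [P+5]*Q⁻¹≡1 = trans (cong (_* Q⁻¹) (sym Q≡)) (*-inverseʳ Q)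
    where Q≡ = trans (ι-+ n 4) (cong (_+ ι 4) (ι-+ 1 p))

  denominator≡ : n ℕ.* n ℕ.+ 3 ℕ.* n ∸ 4 ≡ (n ℕ.+ 4) ℕ.* p
  denominator≡ = trans (cong (_∸ 4) expand) (ℕ.m+n∸n≡m ((n ℕ.+ 4) ℕ.* p) 4)
    where
    open ℕ-Solver.+-*-Solver using () renaming (solve to solveℕ; _:+_ to _⊕_; _:*_ to _⊛_; _:=_ to _≐_; con to c)
    expand : n ℕ.* n ℕ.+ 3 ℕ.* n ≡ (n ℕ.+ 4) ℕ.* p ℕ.+ 4
    expand = solveℕ 1 (λ q → (c 1 ⊕ q) ⊛ (c 1 ⊕ q) ⊕ c 3 ⊛ (c 1 ⊕ q) ≐ ((c 1 ⊕ q) ⊕ c 4) ⊛ q ⊕ c 4) refl p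

  frac-denominator : ∀ a → frac a (n ℕ.* n ℕ.+ 3 ℕ.* n ∸ 4) ≡ fromℤ a * Q⁻¹ * P⁻¹
  frac-denominator a = begin
    frac a (n ℕ.* n ℕ.+ 3 ℕ.* n ∸ 4)   ≡⟨ cong (frac a) denominator≡ ⟩
    x                                  ≡⟨ solve 1 (λ x → x := x :* con 1ℚ :* con 1ℚ) refl x ⟩
    x * 1ℚ * 1ℚ                        ≡⟨ cong₂ (λ u v → x * u * v) (*-inverseʳ Q) P*P⁻¹≡1 ⟨
    x * (Q * Q⁻¹) * (P * P⁻¹)          ≡⟨ solve 5 (λ x Q R P S → x :* (Q :* R) :* (P :* S) := x :* (Q :* P) :* R :* S) refl x Q Q⁻¹ P P⁻¹ ⟩
    x * (Q * P) * Q⁻¹ * P⁻¹            ≡⟨ cong (λ e → e * Q⁻¹ * P⁻¹) x*[Q*P]≡a ⟩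
    fromℤ a * Q⁻¹ * P⁻¹                ∎
    where
    x = frac a ((n ℕ.+ 4) ℕ.* p)
    x*[Q*P]≡a : x * (Q * P) ≡ fromℤ a
    x*[Q*P]≡a = trans (cong (x *_) (sym (ι-* (n ℕ.+ 4) p))) (/-*-cancel a (ℕ.pred ((n ℕ.+ 4) ℕ.* p)))

  w₀ w₁ w₂ : ℚ
  w₀ = frac ((ℤ.+ 13) ℤ.- (ℤ.+ (3 ℕ.* n))) (n ℕ.* n ℕ.+ 3 ℕ.* n ∸ 4)
  w₁ = frac ((ℤ.+ 6) ℤ.- (ℤ.+ n)) (n ℕ.* n ℕ.+ 3 ℕ.* n ∸ 4)
  w₂ = frac (ℤ.+ 1) (n ℕ.+ 4)

  targetVec≡blockVector : ∀ i → targetVec n i ≡ blockVector w₀ w₁ w₂ (toℕ i)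
  targetVec≡blockVector i with blk n (toℕ i)
  ... | b0 = refl
  ... | b1 = refl
  ... | b2 = refl

  private
    fromℤ-difference : ∀ a b → fromℤ ((ℤ.+ a) ℤ.- (ℤ.+ b)) ≡ ι a - ι b
    fromℤ-difference a b = trans (fromℤ-+ (ℤ.+ a) (ℤ.- (ℤ.+ b))) (cong (ι a +_) (fromℤ-neg (ℤ.+ b)))

    ι-n : ι n ≡ 1ℚ + P
    ι-n = ι-+ 1 p

  w₀≡ : w₀ ≡ (ι 13 - ι 3 * (1ℚ + P)) * Q⁻¹ * P⁻¹
  w₀≡ = trans (frac-denominator _) (cong (λ e → e * Q⁻¹ * P⁻¹)
    (trans (fromℤ-difference 13 (3 ℕ.* n)) (cong (λ e → ι 13 - e) (trans (ι-* 3 n) (cong (ι 3 *_) ι-n)))))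

  w₁≡ : w₁ ≡ (ι 6 - (1ℚ + P)) * Q⁻¹ * P⁻¹
  w₁≡ = trans (frac-denominator _) (cong (λ e → e * Q⁻¹ * P⁻¹) (trans (fromℤ-difference 6 n) (cong (λ e → ι 6 - e) ι-n)))

  w₂≡ : w₂ ≡ Q⁻¹
  w₂≡ = begin
    w₂                  ≡⟨ solve 1 (λ w → w := w :* con 1ℚ) refl w₂ ⟩
    w₂ * 1ℚ             ≡⟨ cong (w₂ *_) (*-inverseʳ Q) ⟨
    w₂ * (Q * Q⁻¹)      ≡⟨ *-assoc w₂ Q Q⁻¹ ⟨
    (w₂ * Q) * Q⁻¹      ≡⟨ cong (_* Q⁻¹) (/-*-cancel (ℤ.+ 1) (p ℕ.+ 4)) ⟩
    1ℚ * Q⁻¹            ≡⟨ *-identityˡ Q⁻¹ ⟩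
    Q⁻¹                 ∎

  module W = BlockVector w₀ w₁ w₂

  W-t₀≡1 : W.t₀ ≡ 1ℚ
  W-t₀≡1 = begin
    P * (w₁ + two * w₂)
      ≡⟨ cong₂ (λ a b → P * (a + two * b)) w₁≡ w₂≡ ⟩
    P * ((ι 6 - (1ℚ + P)) * Q⁻¹ * P⁻¹ + two * Q⁻¹)
      ≡⟨ solve 3 (λ P S R → P :* ((con (ι 6) :- (con 1ℚ :+ P)) :* R :* S :+ con two :* R)
                        := (con (ι 6) :- con 1ℚ :- P) :* R :* (P :* S :- con 1ℚ) :+ ((con 1ℚ :+ P) :+ con (ι 4)) :* R) refl P P⁻¹ Q⁻¹ ⟩
    (ι 6 - 1ℚ - P) * Q⁻¹ * (P * P⁻¹ - 1ℚ) + ((1ℚ + P) + ι 4) * Q⁻¹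
      ≡⟨ cong₂ (λ u v → (ι 6 - 1ℚ - P) * Q⁻¹ * (u - 1ℚ) + v) P*P⁻¹≡1 [P+5]*Q⁻¹≡1 ⟩
    (ι 6 - 1ℚ - P) * Q⁻¹ * (1ℚ - 1ℚ) + 1ℚ
      ≡⟨ solve 2 (λ P R → (con (ι 6) :- con 1ℚ :- P) :* R :* (con 1ℚ :- con 1ℚ) :+ con 1ℚ := con 1ℚ) refl P Q⁻¹ ⟩
    1ℚ ∎

  W-t₁≡1 : W.t₁ ≡ 1ℚ
  W-t₁≡1 = begin
    (w₀ - P * w₂) + (two * P - two) * (w₁ + two * w₂)
      ≡⟨ cong₃ (λ a b c → (a - P * c) + (two * P - two) * (b + two * c)) w₀≡ w₁≡ w₂≡ ⟩
    ((ι 13 - ι 3 * (1ℚ + P)) * Q⁻¹ * P⁻¹ - P * Q⁻¹) + (two * P - two) * ((ι 6 - (1ℚ + P)) * Q⁻¹ * P⁻¹ + two * Q⁻¹)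
      ≡⟨ solve 3 (λ P S R → ((con (ι 13) :- con (ι 3) :* (con 1ℚ :+ P)) :* R :* S :- P :* R) :+ (con two :* P :- con two) :* ((con (ι 6) :- (con 1ℚ :+ P)) :* R :* S :+ con two :* R)
                        := (con (ι 9) :- con two :* P) :* R :* (P :* S :- con 1ℚ) :+ ((con 1ℚ :+ P) :+ con (ι 4)) :* R) refl P P⁻¹ Q⁻¹ ⟩
    (ι 9 - two * P) * Q⁻¹ * (P * P⁻¹ - 1ℚ) + ((1ℚ + P) + ι 4) * Q⁻¹
      ≡⟨ cong₂ (λ u v → (ι 9 - two * P) * Q⁻¹ * (u - 1ℚ) + v) P*P⁻¹≡1 [P+5]*Q⁻¹≡1 ⟩
    (ι 9 - two * P) * Q⁻¹ * (1ℚ - 1ℚ) + 1ℚ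
      ≡⟨ solve 2 (λ P R → (con (ι 9) :- con two :* P) :* R :* (con 1ℚ :- con 1ℚ) :+ con 1ℚ := con 1ℚ) refl P Q⁻¹ ⟩
    1ℚ ∎
    where
    cong₃ : ∀ {A : Set} (f : ℚ → ℚ → ℚ → A) {a a′ b b′ c c′} → a ≡ a′ → b ≡ b′ → c ≡ c′ → f a b c ≡ f a′ b′ c′
    cong₃ f refl refl refl = refl

  2w₁-w₀≡w₂ : two * w₁ - w₀ ≡ w₂
  2w₁-w₀≡w₂ = begin
    two * w₁ - w₀
      ≡⟨ cong₂ (λ a b → two * a - b) w₁≡ w₀≡ ⟩
    two * ((ι 6 - (1ℚ + P)) * Q⁻¹ * P⁻¹) - (ι 13 - ι 3 * (1ℚ + P)) * Q⁻¹ * P⁻¹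
      ≡⟨ solve 3 (λ P S R → con two :* ((con (ι 6) :- (con 1ℚ :+ P)) :* R :* S) :- (con (ι 13) :- con (ι 3) :* (con 1ℚ :+ P)) :* R :* S := (P :* S) :* R) refl P P⁻¹ Q⁻¹ ⟩
    (P * P⁻¹) * Q⁻¹
      ≡⟨ cong (_* Q⁻¹) P*P⁻¹≡1 ⟩
    1ℚ * Q⁻¹
      ≡⟨ *-identityˡ Q⁻¹ ⟩
    Q⁻¹
      ≡⟨ w₂≡ ⟨
    w₂ ∎

  blockVector-const : ∀ a x → blockVector a a a x ≡ a
  blockVector-const a x with blk n x
  ... | b0 = refl
  ... | b1 = refl
  ... | b2 = refl

  D·w≡1 : ∀ c → (D ·ᵥ W.y) c ≡ 1ℚ
  D·w≡1 c = begin
    (D ·ᵥ W.y) c                                     ≡⟨ W.D·y c ⟩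
    blockVector W.t₀ W.t₁ (two * W.t₁ - W.t₀) (toℕ c) ≡⟨ cong₂ (λ a b → blockVector a b (two * b - a) (toℕ c)) W-t₀≡1 W-t₁≡1 ⟩
    blockVector 1ℚ 1ℚ 1ℚ (toℕ c)                      ≡⟨ blockVector-const 1ℚ (toℕ c) ⟩
    1ℚ                                               ∎

  -- The solution of P (z₁ + 2 z₂) = w₀ and -P z₂ + (2P - 2)(z₁ + 2 z₂) = w₁, so that z = (0, z₁, z₂) has D z = w.
  z₁ z₂ : ℚ
  z₂ = - (w₁ - (two * P - two) * w₀ * P⁻¹) * P⁻¹
  z₁ = w₀ * P⁻¹ - two * z₂

  module Z = BlockVector 0ℚ z₁ z₂

  Z-t₀≡w₀ : Z.t₀ ≡ w₀
  Z-t₀≡w₀ = begin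
    P * (z₁ + two * z₂)  ≡⟨ solve 4 (λ P S w z → P :* ((w :* S :- con two :* z) :+ con two :* z) := (P :* S) :* w) refl P P⁻¹ w₀ z₂ ⟩
    (P * P⁻¹) * w₀       ≡⟨ cong (_* w₀) P*P⁻¹≡1 ⟩
    1ℚ * w₀              ≡⟨ *-identityˡ w₀ ⟩
    w₀                   ∎

  Z-t₁≡w₁ : Z.t₁ ≡ w₁
  Z-t₁≡w₁ = begin
    (0ℚ - P * z₂) + (two * P - two) * (z₁ + two * z₂)
      ≡⟨ solve 4 (λ P S w₀ w₁ → (con 0ℚ :- P :* (:- (w₁ :- (con two :* P :- con two) :* w₀ :* S) :* S))
                                 :+ (con two :* P :- con two) :* ((w₀ :* S :- con two :* (:- (w₁ :- (con two :* P :- con two) :* w₀ :* S) :* S)) :+ con two :* (:- (w₁ :- (con two :* P :- con two) :* w₀ :* S) :* S))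
                             := (w₁ :- (con two :* P :- con two) :* w₀ :* S) :* (P :* S) :+ (con two :* P :- con two) :* w₀ :* S) refl P P⁻¹ w₀ w₁ ⟩
    r * (P * P⁻¹) + (two * P - two) * w₀ * P⁻¹
      ≡⟨ cong (λ e → r * e + (two * P - two) * w₀ * P⁻¹) P*P⁻¹≡1 ⟩
    r * 1ℚ + (two * P - two) * w₀ * P⁻¹
      ≡⟨ solve 4 (λ P S w₀ w₁ → (w₁ :- (con two :* P :- con two) :* w₀ :* S) :* con 1ℚ :+ (con two :* P :- con two) :* w₀ :* S := w₁) refl P P⁻¹ w₀ w₁ ⟩
    w₁ ∎
    where r = w₁ - (two * P - two) * w₀ * P⁻¹

  D·z≡w : ∀ c → (D ·ᵥ Z.y) c ≡ W.y c
  D·z≡w c = begin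
    (D ·ᵥ Z.y) c                                     ≡⟨ Z.D·y c ⟩
    blockVector Z.t₀ Z.t₁ (two * Z.t₁ - Z.t₀) (toℕ c) ≡⟨ cong₂ (λ a b → blockVector a b (two * b - a) (toℕ c)) Z-t₀≡w₀ Z-t₁≡w₁ ⟩
    blockVector w₀ w₁ (two * w₁ - w₀) (toℕ c)         ≡⟨ cong (λ e → blockVector w₀ w₁ e (toℕ c)) 2w₁-w₀≡w₂ ⟩
    W.y c                                            ∎


open import Defs
open import Data.Nat using (_≤_; _*_; _∸_; zero; suc; s≤s)
open import Data.Nat.Divisibility using (_∣_)
open import Data.Product using (Σ; _×_; _,_; proj₁; proj₂)
open import Relation.Binary.PropositionalEquality using (_≡_; sym; trans)

module GearMoorePenrose (k : ℕ) where

  open Matrices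
  open ShermanMorrison using (I+KKᵗ-inverse; rightInverse⇒leftInverse)
  open GearIndices k using (p)
  open GearEntries k using (n)
  open GearFactorization k
  open StarInverse k
  open GearOnes k

  private
    I+KKᵗ⁻¹ = I+KKᵗ-inverse p K
    G = proj₁ I+KKᵗ⁻¹
    G-sym = proj₂ (proj₂ I+KKᵗ⁻¹)
    F·Fᵗ·G≈I = ≈ₘ-trans (·-congʳ G F·Fᵗ≈I+KKᵗ) (proj₁ (proj₂ I+KKᵗ⁻¹))

  open MoorePenrose.FromFactorization D F M M⁻¹ G D≈FᵗMF M·M⁻¹≈I (rightInverse⇒leftInverse M-sym M⁻¹-sym M·M⁻¹≈I)
    F·Fᵗ·G≈I (rightInverse⇒leftInverse (transpose-· F (transpose F)) G-sym F·Fᵗ·G≈I) G-sym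
    public using (X; isMoorePenrose)

  D†·1≡target : (X′ : Matrix N N) → IsMoorePenrose D X′ → ∀ i → (X′ ·ᵥ ones N) i ≡ targetVec n i
  D†·1≡target X′ mp i = trans (·ᵥ-onImage (ones N) W.y Z.y D·z≡w D·w≡1 i) (sym (targetVec≡blockVector i))
    where open MoorePenrose.OfSymmetric D-sym mp

lemma8 : (n : ℕ) → 2 ∣ n → 4 ≤ n →
    Σ (Matrix (2 * n ∸ 1) (2 * n ∸ 1)) (IsMoorePenrose (gearD n))
    × ((X : Matrix (2 * n ∸ 1) (2 * n ∸ 1)) → IsMoorePenrose (gearD n) X →
        ∀ i → (X ·ᵥ ones (2 * n ∸ 1)) i ≡ targetVec n i)
lemma8 (suc (suc (suc (suc k)))) _ _ = (X , isMoorePenrose) , D†·1≡target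
  where open GearMoorePenrose k
lemma8 zero _ ()
lemma8 (suc zero) _ (s≤s ())
lemma8 (suc (suc zero)) _ (s≤s (s≤s ()))
lemma8 (suc (suc (suc zero))) _ (s≤s (s≤s (s≤s ())))
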